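{- Let $n\ge 1$, let $H=(V,E)$ be a hypergraph with vertex set $V=\{1,\dots,t\}$ in which every edge has at least two vertices, and let $d$ be the maximal size of an edge of $H$. Let $f:\{0,1\}^n\to\{ -1,1\}$. Consider the following random test: choose $x_1,\dots,x_t\in\{0,1\}^n$ independently and uniformly at random, and accept if and only if for every edge $e\in E$ $$\prod_{i\in e} f(x_i)\cdot f\Big(\sum_{i\in e}x_i\Big)=f(0)^{|e|+1}.$$ Then the probability that this test accepts $f$ is at most $$\frac{1}{2^{|E|}}+\|f\|_{U_d}.$$
   Context: Addition in $\{0,1\}^n$ is coordinatewise modulo $2$ (i.e. in $\mathbb{F}_2^n$). For a function $f:\{0,1\}^n\to\mathbb{R}$ and an integer $d\ge1$, the $d$-th Gowers uniformity norm is $$\|f\|_{U_d}=\Big[\mathbb{E}_{x,y_1,\dots,y_d}\prod_{S\subseteq\{1,\dots,d\}} f\Big(x+\sum_{i\in S}y_i\Big)\Big]^{1/2^d},$$ where $x,y_1,\dots,y_d$ are independent and uniform in $\{0,1\}^n$. -}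

module Defs where

open import Data.Bool using (Bool; true; false; if_then_else_; _xor_)
open import Data.Nat as ℕ using (ℕ; zero; suc; _⊔_)
open import Data.Nat.Properties using (m^n≢0)
open import Data.Integer as ℤ using (ℤ)
open import Data.Rational as ℚ using (ℚ)
open import Data.Vec using (Vec; []; _∷_; lookup; zipWith; replicate)
open import Data.Fin using (Fin)
open import Data.List as List using (List; []; _∷_; map; concatMap; foldr; filter; length; allFin)
open import Data.List.Relation.Unary.All using (All)
open import Relation.Nullary using (Dec)
open import Relation.Binary.PropositionalEquality using (_≡_)
open import Data.Sum using (_⊎_)
import Data.List.Relation.Unary.All as All

Cube : ℕ → Set
Cube n = Vec Bool n

_⊕_ : ∀ {n} → Cube n → Cube n → Cube n
_⊕_ = zipWith _xor_

𝟘 : ∀ {n} → Cube n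
𝟘 = replicate _ false

vecsOf : ∀ {A : Set} → List A → (k : ℕ) → List (Vec A k)
vecsOf xs zero = [] ∷ []
vecsOf xs (suc k) = concatMap (λ a → map (a ∷_) (vecsOf xs k)) xs

cube : (n : ℕ) → List (Cube n)
cube n = vecsOf (true ∷ false ∷ []) n

tuples : (n t : ℕ) → List (Vec (Cube n) t)
tuples n t = vecsOf (cube n) t

sumℤ : List ℤ → ℤ
sumℤ = foldr ℤ._+_ (ℤ.+ 0)

prodℤ : List ℤ → ℤ
prodℤ = foldr ℤ._*_ (ℤ.+ 1)

-- A subset S of {1..k} is a characteristic vector (as Data.Fin.Subset).
-- Σ_{i ∈ S} y_i in F_2^n
subsetSum : ∀ {n k} → Vec Bool k → Vec (Cube n) k → Cube n
subsetSum {n} {k} S ys =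
  foldr (λ i acc → if lookup S i then lookup ys i ⊕ acc else acc) 𝟘 (allFin k)

subsetProd : ∀ {n k} → (Cube n → ℤ) → Vec Bool k → Vec (Cube n) k → ℤ
subsetProd {n} {k} f S xs =
  foldr (λ i acc → if lookup S i then f (lookup xs i) ℤ.* acc else acc) (ℤ.+ 1) (allFin k)

size : ∀ {k} → Vec Bool k → ℕ
size [] = 0
size (true ∷ S) = suc (size S)
size (false ∷ S) = size S

_^ℚ_ : ℚ → ℕ → ℚ
q ^ℚ zero = ℚ.1ℚ
q ^ℚ suc k = q ℚ.* (q ^ℚ k)

_/2^_ : ℤ → ℕ → ℚ
a /2^ m = ℚ._/_ a (2 ℕ.^ m) {{m^n≢0 2 m}}

-- ‖f‖_{U_d}^{2^d}
--   = E_{x,y_1..y_d} Π_{S ⊆ {1..d}} f(x + Σ_{i∈S} y_i)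
gowersPow : ∀ {n} → (d : ℕ) → (Cube n → ℤ) → ℚ
gowersPow {n} d f =
  sumℤ (concatMap (λ x → map (λ ys →
      prodℤ (map (λ S → f (x ⊕ subsetSum S ys)) (cube d)))
    (tuples n d)) (cube n))
  /2^ (n ℕ.* suc d)

-- "a ≤ b + ‖f‖_{U_d}" for rationals a, b.  Since ‖f‖_{U_d} is the
-- nonnegative 2^d-th root of gowersPow d f, this says:
-- a - b ≤ 0, or (a - b)^(2^d) ≤ ‖f‖_{U_d}^(2^d).
LeqPlusGowers : ∀ {n} → ℚ → ℚ → (d : ℕ) → (Cube n → ℤ) → Set
LeqPlusGowers a b d f =
  ℚ._≤_ (a ℚ.- b) ℚ.0ℚ ⊎ ℚ._≤_ ((a ℚ.- b) ^ℚ (2 ℕ.^ d)) (gowersPow d f)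

-- Hypergraph on vertex set {1..t} (= Fin t): a list of edges, each edge a subset of Fin t.
-- Maximal edge size.
maxEdge : ∀ {t} → List (Vec Bool t) → ℕ
maxEdge E = foldr (λ e m → size e ⊔ m) 0 E

Accepts : ∀ {n t} → (Cube n → ℤ) → List (Vec Bool t) → Vec (Cube n) t → Set
Accepts f E xs =
  All (λ e → subsetProd f e xs ℤ.* f (subsetSum e xs) ≡ f 𝟘 ℤ.^ suc (size e)) E

accepts? : ∀ {n t} (f : Cube n → ℤ) (E : List (Vec Bool t)) (xs : Vec (Cube n) t) → Dec (Accepts f E xs)
accepts? f E xs = All.all? (λ e → subsetProd f e xs ℤ.* f (subsetSum e xs) ℤ.≟ f 𝟘 ℤ.^ suc (size e)) E

acceptProb : ∀ {n t} → (Cube n → ℤ) → List (Vec Bool t) → ℚ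
acceptProb {n} {t} f E =
  (ℤ.+ (length (filter (accepts? f E) (tuples n t)))) /2^ (n ℕ.* t)

module Submission where

-- A ±1-valued f passes the test at x = (x₁,…,x_t) iff 1 + c_e g_e(x) = 2 for every edge e, where
-- g_e(x) = ∏_{i∈e} f(x_i) · f(∑_{i∈e} x_i) and c_e = f(0)^{|e|+1}; otherwise some factor vanishes. Hence
--   2^|E| · #accepted = ∑_x ∏_{e∈E} (1 + c_e g_e(x)) = 2^{nt} + ∑_{∅≠F⊆E} ∑_x ∏_{e∈F} c_e g_e(x).
-- In the term of F pick an edge e₀ ∈ F of maximal size. The term is ∑_x f(∑_{i∈e₀} x_i) times ±1 factors each of
-- which ignores some x_j with j ∈ e₀: f(x_i) ignores x_j for any other j ∈ e₀, and f(∑_{i∈e} x_i) with e ≠ e₀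
-- ignores the x_j for a vertex j ∈ e₀ ∖ e, which exists as the edges are distinct and |e| ≤ |e₀|. Cauchy–Schwarz
-- in each variable of e₀ bounds the term by 2^{nt} ‖f‖_{U_{|e₀|}} ≤ 2^{nt} ‖f‖_{U_d}, and the power-mean
-- inequality over the 2^|E| − 1 terms turns this into Pr[accept] − 2^{−|E|} ≤ ‖f‖_{U_d}.

open import Defs
open import Data.Bool using (Bool)
open import Data.Nat using (ℕ; _≤_; _≥_)
open import Data.Integer using (ℤ; +_; -_)
open import Data.Vec using (Vec)
open import Data.List using (List; length)
open import Data.List.Relation.Unary.All using (All)
open import Data.List.Relation.Unary.Unique.Propositional using (Unique)
open import Data.List.Relation.Unary.Any using (Any)
open import Data.List.Relation.Unary.Any using (here; there)
open import Data.Sum using (_⊎_)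
open import Data.Unit using (⊤)
open import Relation.Binary.PropositionalEquality using (_≡_)

open import Data.Bool using (true; false; if_then_else_)
open import Data.Bool.Properties using (xor-comm; xor-assoc; xor-identityʳ)
open import Data.Nat as ℕ using (zero; suc)
import Data.Nat.Properties as ℕ
open import Data.Integer as ℤ using (0ℤ; 1ℤ; _+_; _*_; _-_; _^_)
import Data.Integer.Properties as ℤ
open import Data.Integer.Tactic.RingSolver using (solve-∀)
open import Algebra.Properties.CommutativeSemigroup ℤ.+-commutativeSemigroup using () renaming (interchange to +-interchange)
open import Algebra.Properties.CommutativeSemigroup ℤ.*-commutativeSemigroup using ()
  renaming (interchange to *-interchange; x∙yz≈y∙xz to *-left-comm; xy∙z≈xz∙y to *-right-comm)
open import Data.Fin as Fin using (Fin)
import Data.Fin.Properties as Fin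
open import Data.Vec as Vec using ([]; _∷_; lookup; _[_]≔_)
import Data.Vec.Properties as Vec
open import Data.List as List using ([]; _∷_; map; concatMap; _++_; foldr)
import Data.List.Properties as List
import Data.List.Relation.Unary.All as All
import Data.List.Relation.Unary.All.Properties as All
import Data.List.Relation.Unary.AllPairs as AllPairs
open import Data.List.Relation.Binary.Sublist.Propositional as Sublist using (_⊆_; _∷ʳ_)
open import Data.List.Relation.Binary.Sublist.Propositional.Properties using (All-resp-⊆)
open import Data.Product as Product using (Σ; _×_; _,_; proj₁; proj₂)
open import Data.Sum using (inj₁; inj₂)
open import Data.Empty using (⊥-elim)
open import Function using (_∘_; id)
open import Relation.Nullary using (¬_; yes; no; Dec)
open import Relation.Binary.PropositionalEquality using (refl; sym; trans; cong; cong₂; subst; _≢_; module ≡-Reasoning)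
open import Data.Rational.Unnormalised as ℚᵘ using (ℚᵘ; mkℚᵘ; ↥_; ↧_)
import Data.Rational.Unnormalised.Properties as ℚᵘ
import Data.Rational as ℚ
import Data.Rational.Properties as ℚ

module _ {A : Set} where

  ∑ : List A → (A → ℤ) → ℤ
  ∑ []       g = 0ℤ
  ∑ (x ∷ xs) g = g x + ∑ xs g

  ∏ : List A → (A → ℤ) → ℤ
  ∏ []       g = 1ℤ
  ∏ (x ∷ xs) g = g x * ∏ xs g

  syntax ∑ xs (λ x → e) = ∑[ x ∈ xs ] e
  syntax ∏ xs (λ x → e) = ∏[ x ∈ xs ] e

  ∑-cong : ∀ xs {g h : A → ℤ} → (∀ x → g x ≡ h x) → ∑ xs g ≡ ∑ xs h
  ∑-cong []       g≗h = refl
  ∑-cong (x ∷ xs) g≗h = cong₂ _+_ (g≗h x) (∑-cong xs g≗h)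

  ∏-cong : ∀ xs {g h : A → ℤ} → (∀ x → g x ≡ h x) → ∏ xs g ≡ ∏ xs h
  ∏-cong []       g≗h = refl
  ∏-cong (x ∷ xs) g≗h = cong₂ _*_ (g≗h x) (∏-cong xs g≗h)

  ∑-++ : ∀ xs ys (g : A → ℤ) → ∑ (xs ++ ys) g ≡ ∑ xs g + ∑ ys g
  ∑-++ []       ys g = sym (ℤ.+-identityˡ _)
  ∑-++ (x ∷ xs) ys g = trans (cong (_+_ (g x)) (∑-++ xs ys g)) (sym (ℤ.+-assoc (g x) _ _))

  ∏-++ : ∀ xs ys (g : A → ℤ) → ∏ (xs ++ ys) g ≡ ∏ xs g * ∏ ys g
  ∏-++ []       ys g = sym (ℤ.*-identityˡ _)
  ∏-++ (x ∷ xs) ys g = trans (cong (g x *_) (∏-++ xs ys g)) (sym (ℤ.*-assoc (g x) _ _))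

  ∑-+ : ∀ xs (g h : A → ℤ) → ∑[ x ∈ xs ] (g x + h x) ≡ ∑ xs g + ∑ xs h
  ∑-+ []       g h = refl
  ∑-+ (x ∷ xs) g h = trans (cong (_+_ (g x + h x)) (∑-+ xs g h)) (+-interchange (g x) (h x) _ _)

  ∏-* : ∀ xs (g h : A → ℤ) → ∏[ x ∈ xs ] (g x * h x) ≡ ∏ xs g * ∏ xs h
  ∏-* []       g h = refl
  ∏-* (x ∷ xs) g h = trans (cong (g x * h x *_) (∏-* xs g h)) (*-interchange (g x) (h x) _ _)

  ∑-0 : ∀ xs → ∑[ x ∈ xs ] 0ℤ ≡ 0ℤ
  ∑-0 []       = refl
  ∑-0 (x ∷ xs) = trans (ℤ.+-identityˡ _) (∑-0 xs)

  ∑-*ˡ : ∀ xs c (g : A → ℤ) → ∑[ x ∈ xs ] (c * g x) ≡ c * ∑ xs g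
  ∑-*ˡ []       c g = sym (ℤ.*-zeroʳ c)
  ∑-*ˡ (x ∷ xs) c g = trans (cong (_+_ (c * g x)) (∑-*ˡ xs c g)) (sym (ℤ.*-distribˡ-+ c (g x) _))

  ∑-*ʳ : ∀ xs c (g : A → ℤ) → ∑[ x ∈ xs ] (g x * c) ≡ ∑ xs g * c
  ∑-*ʳ xs c g = trans (∑-cong xs (λ x → ℤ.*-comm (g x) c)) (trans (∑-*ˡ xs c g) (ℤ.*-comm c (∑ xs g)))

  ∑-const : ∀ xs c → ∑[ x ∈ xs ] c ≡ + length xs * c
  ∑-const []       c = sym (ℤ.*-zeroˡ c)
  ∑-const (x ∷ xs) c = trans (cong (_+_ c) (∑-const xs c)) (sym (ℤ.suc-* (+ length xs) c))

  ∑-mono-≤ : ∀ xs {g h : A → ℤ} → All (λ x → g x ℤ.≤ h x) xs → ∑ xs g ℤ.≤ ∑ xs h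
  ∑-mono-≤ []       All.[]              = ℤ.≤-refl
  ∑-mono-≤ (x ∷ xs) (g≤h All.∷ gs≤hs) = ℤ.+-mono-≤ g≤h (∑-mono-≤ xs gs≤hs)

  ∑-1 : ∀ xs → ∑[ x ∈ xs ] 1ℤ ≡ + length xs
  ∑-1 xs = trans (∑-const xs 1ℤ) (ℤ.*-identityʳ _)

  ∑-filter : ∀ {P : A → Set} (P? : ∀ x → Dec (P x)) xs (h : A → ℤ) c →
    (∀ x → P x → h x ≡ c) → (∀ x → ¬ P x → h x ≡ 0ℤ) → ∑ xs h ≡ + length (List.filter P? xs) * c
  ∑-filter P? []       h c yes⇒c no⇒0 = sym (ℤ.*-zeroˡ c)
  ∑-filter P? (x ∷ xs) h c yes⇒c no⇒0 with P? x
  ... | yes p = trans (cong₂ _+_ (yes⇒c x p) (∑-filter P? xs h c yes⇒c no⇒0)) (sym (ℤ.suc-* (+ length (List.filter P? xs)) c))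
  ... | no ¬p = trans (cong₂ _+_ (no⇒0 x ¬p) (∑-filter P? xs h c yes⇒c no⇒0)) (ℤ.+-identityˡ _)

  ∏-++-∷ : ∀ G₁ {x G₂} (g : A → ℤ) → ∏ (G₁ ++ x ∷ G₂) g ≡ g x * ∏ (G₁ ++ G₂) g
  ∏-++-∷ []       g = refl
  ∏-++-∷ (y ∷ G₁) {x} {G₂} g = trans (cong (_*_ (g y)) (∏-++-∷ G₁ g)) (*-left-comm (g y) (g x) (∏ (G₁ ++ G₂) g))

module _ {A B : Set} where

  ∑-map : ∀ (h : A → B) xs (g : B → ℤ) → ∑ (map h xs) g ≡ ∑ xs (g ∘ h)
  ∑-map h []       g = refl
  ∑-map h (x ∷ xs) g = cong (_+_ (g (h x))) (∑-map h xs g)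

  ∏-map : ∀ (h : A → B) xs (g : B → ℤ) → ∏ (map h xs) g ≡ ∏ xs (g ∘ h)
  ∏-map h []       g = refl
  ∏-map h (x ∷ xs) g = cong (g (h x) *_) (∏-map h xs g)

  ∑-concatMap : ∀ (h : A → List B) xs (g : B → ℤ) → ∑ (concatMap h xs) g ≡ ∑[ x ∈ xs ] ∑ (h x) g
  ∑-concatMap h []       g = refl
  ∑-concatMap h (x ∷ xs) g = trans (∑-++ (h x) (concatMap h xs) g) (cong (_+_ (∑ (h x) g)) (∑-concatMap h xs g))

  ∑-comm : ∀ xs ys (g : A → B → ℤ) → ∑[ x ∈ xs ] ∑[ y ∈ ys ] g x y ≡ ∑[ y ∈ ys ] ∑[ x ∈ xs ] g x y
  ∑-comm []       ys g = sym (∑-0 ys)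
  ∑-comm (x ∷ xs) ys g = trans (cong (_+_ (∑ ys (g x))) (∑-comm xs ys g)) (sym (∑-+ ys (g x) _))

-- Cauchy–Schwarz and power means

square-nonNeg : ∀ a → 0ℤ ℤ.≤ a * a
square-nonNeg (+ m)       = subst (0ℤ ℤ.≤_) (ℤ.pos-* m m) (ℤ.+≤+ ℕ.z≤n)
square-nonNeg ℤ.-[1+ m ] = ℤ.+≤+ ℕ.z≤n

*-monoˡ-≤-nonNeg′ : ∀ {c a b} → 0ℤ ℤ.≤ c → a ℤ.≤ b → c * a ℤ.≤ c * b
*-monoˡ-≤-nonNeg′ {c} 0≤c = ℤ.*-monoˡ-≤-nonNeg c {{ℤ.nonNegative 0≤c}}

*-monoʳ-≤-nonNeg′ : ∀ {c a b} → 0ℤ ℤ.≤ c → a ℤ.≤ b → a * c ℤ.≤ b * c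
*-monoʳ-≤-nonNeg′ {c} 0≤c = ℤ.*-monoʳ-≤-nonNeg c {{ℤ.nonNegative 0≤c}}

*-cancelˡ-≤-pos′ : ∀ {c a b} → 0ℤ ℤ.< c → c * a ℤ.≤ c * b → a ℤ.≤ b
*-cancelˡ-≤-pos′ {c} {a} {b} 0<c = ℤ.*-cancelˡ-≤-pos a b c {{ℤ.positive 0<c}}

*-nonNeg : ∀ {a b} → 0ℤ ℤ.≤ a → 0ℤ ℤ.≤ b → 0ℤ ℤ.≤ a * b
*-nonNeg {a} {b} 0≤a 0≤b = subst (ℤ._≤ a * b) (ℤ.*-zeroʳ a) (*-monoˡ-≤-nonNeg′ 0≤a 0≤b)

*-pos : ∀ {a b} → 0ℤ ℤ.< a → 0ℤ ℤ.< b → 0ℤ ℤ.< a * b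
*-pos {a} {b} 0<a 0<b = subst (ℤ._< a * b) (ℤ.*-zeroʳ a) (ℤ.*-monoˡ-<-pos a {{ℤ.positive 0<a}} 0<b)

^-nonNeg : ∀ {c} m → 0ℤ ℤ.≤ c → 0ℤ ℤ.≤ c ^ m
^-nonNeg zero    0≤c = ℤ.+≤+ ℕ.z≤n
^-nonNeg (suc m) 0≤c = *-nonNeg 0≤c (^-nonNeg m 0≤c)

^-pos : ∀ {c} m → 0ℤ ℤ.< c → 0ℤ ℤ.< c ^ m
^-pos zero    0<c = ℤ.+<+ (ℕ.s≤s ℕ.z≤n)
^-pos (suc m) 0<c = *-pos 0<c (^-pos m 0<c)

+-self-nonNeg⇒nonNeg : ∀ x → 0ℤ ℤ.≤ x + x → 0ℤ ℤ.≤ x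
+-self-nonNeg⇒nonNeg (+ m)       _   = ℤ.+≤+ ℕ.z≤n
+-self-nonNeg⇒nonNeg ℤ.-[1+ m ] 0≤x+x = ⊥-elim (ℤ.<⇒≱ (ℤ.+-mono-< (ℤ.-<+ {m} {0}) (ℤ.-<+ {m} {0})) 0≤x+x)

infixr 8 _^2^_

_^2^_ : ℤ → ℕ → ℤ
a ^2^ zero  = a
a ^2^ suc j = (a * a) ^2^ j

^2^-distribʳ-* : ∀ j a b → (a * b) ^2^ j ≡ a ^2^ j * b ^2^ j
^2^-distribʳ-* zero    a b = refl
^2^-distribʳ-* (suc j) a b = trans (cong (_^2^ j) (*-interchange a b a b)) (^2^-distribʳ-* j (a * a) (b * b))

^2^-nonNeg : ∀ j {a} → 0ℤ ℤ.≤ a → 0ℤ ℤ.≤ a ^2^ j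
^2^-nonNeg zero    0≤a = 0≤a
^2^-nonNeg (suc j) {a} _ = ^2^-nonNeg j (square-nonNeg a)

^2^-suc-nonNeg : ∀ j a → 0ℤ ℤ.≤ a ^2^ suc j
^2^-suc-nonNeg j a = ^2^-nonNeg j (square-nonNeg a)

^2^-mono-≤ : ∀ j {a b} → 0ℤ ℤ.≤ a → a ℤ.≤ b → a ^2^ j ℤ.≤ b ^2^ j
^2^-mono-≤ zero    0≤a a≤b = a≤b
^2^-mono-≤ (suc j) {a} 0≤a a≤b =
  ^2^-mono-≤ j (square-nonNeg a) (ℤ.≤-trans (*-monoʳ-≤-nonNeg′ 0≤a a≤b) (*-monoˡ-≤-nonNeg′ (ℤ.≤-trans 0≤a a≤b) a≤b))

^2^≡^ : ∀ j a → a ^2^ j ≡ a ^ (2 ℕ.^ j)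
^2^≡^ zero    a = sym (ℤ.^-identityʳ a)
^2^≡^ (suc j) a = begin
  (a * a) ^2^ j          ≡⟨ ^2^≡^ j (a * a) ⟩
  (a * a) ^ (2 ℕ.^ j)    ≡⟨ cong (λ b → (a * b) ^ (2 ℕ.^ j)) (sym (ℤ.*-identityʳ a)) ⟩
  (a ^ 2) ^ (2 ℕ.^ j)    ≡⟨ ℤ.^-*-assoc a 2 (2 ℕ.^ j) ⟩
  a ^ (2 ℕ.^ suc j)      ∎
  where open ≡-Reasoning

module _ {A : Set} where

  cauchy-schwarz : ∀ xs (g : A → ℤ) → ∑ xs g * ∑ xs g ℤ.≤ + length xs * ∑[ x ∈ xs ] (g x * g x)
  cauchy-schwarz xs g = ℤ.0≤i-j⇒j≤i (+-self-nonNeg⇒nonNeg _ (subst (0ℤ ℤ.≤_) lagrange sum-of-squares-nonNeg))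
    where
    L = + length xs
    S = ∑ xs g
    Q = ∑[ x ∈ xs ] (g x * g x)
    D = ∑[ a ∈ xs ] ∑[ b ∈ xs ] ((g a - g b) * (g a - g b))
    sum-of-squares-nonNeg : 0ℤ ℤ.≤ D
    sum-of-squares-nonNeg = subst (ℤ._≤ D) (∑-0 xs) (∑-mono-≤ xs (All.universal (λ a →
      subst (ℤ._≤ ∑[ b ∈ xs ] ((g a - g b) * (g a - g b))) (∑-0 xs) (∑-mono-≤ xs (All.universal (λ b → square-nonNeg (g a - g b)) xs))) xs))
    inner : ∀ u → ∑[ b ∈ xs ] ((u - g b) * (u - g b)) ≡ L * (u * u) + (Q + (- (S + S)) * u)
    inner u = begin
      ∑[ b ∈ xs ] ((u - g b) * (u - g b))                    ≡⟨ ∑-cong xs (λ b → square-diff u (g b)) ⟩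
      ∑[ b ∈ xs ] (u * u + (g b * g b + (- (u + u)) * g b))  ≡⟨ ∑-+ xs _ _ ⟩
      ∑[ b ∈ xs ] (u * u) + ∑[ b ∈ xs ] (g b * g b + (- (u + u)) * g b)
        ≡⟨ cong₂ _+_ (∑-const xs (u * u)) (trans (∑-+ xs _ _) (cong (_+_ Q) (∑-*ˡ xs (- (u + u)) g))) ⟩
      L * (u * u) + (Q + (- (u + u)) * S)                    ≡⟨ swap-linear L (u * u) Q u S ⟩
      L * (u * u) + (Q + (- (S + S)) * u)                    ∎
      where
      open ≡-Reasoning
      square-diff : ∀ u v → (u - v) * (u - v) ≡ u * u + (v * v + (- (u + u)) * v)
      square-diff = solve-∀
      swap-linear : ∀ l w q u s → l * w + (q + (- (u + u)) * s) ≡ l * w + (q + (- (s + s)) * u)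
      swap-linear = solve-∀
    lagrange : D ≡ (L * Q - S * S) + (L * Q - S * S)
    lagrange = begin
      D                                                      ≡⟨ ∑-cong xs (λ a → inner (g a)) ⟩
      ∑[ a ∈ xs ] (L * (g a * g a) + (Q + (- (S + S)) * g a)) ≡⟨ ∑-+ xs _ _ ⟩
      ∑[ a ∈ xs ] (L * (g a * g a)) + ∑[ a ∈ xs ] (Q + (- (S + S)) * g a)
        ≡⟨ cong₂ _+_ (∑-*ˡ xs L (λ a → g a * g a)) (trans (∑-+ xs _ _) (cong₂ _+_ (∑-const xs Q) (∑-*ˡ xs (- (S + S)) g))) ⟩
      L * Q + (L * Q + (- (S + S)) * S)                      ≡⟨ collect L Q S ⟩
      (L * Q - S * S) + (L * Q - S * S)                      ∎
      where
      open ≡-Reasoning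
      collect : ∀ l q s → l * q + (l * q + (- (s + s)) * s) ≡ (l * q - s * s) + (l * q - s * s)
      collect = solve-∀

  power-mean : ∀ j xs (g : A → ℤ) → ∑ xs g ^2^ j * + length xs ℤ.≤ (+ length xs) ^2^ j * ∑[ x ∈ xs ] (g x ^2^ j)
  power-mean zero    xs g = ℤ.≤-reflexive (ℤ.*-comm (∑ xs g) _)
  power-mean (suc j) xs g = begin
    (S * S) ^2^ j * L            ≤⟨ *-monoʳ-≤-nonNeg′ 0≤L (^2^-mono-≤ j (square-nonNeg S) (cauchy-schwarz xs g)) ⟩
    (L * Q) ^2^ j * L            ≡⟨ cong (_* L) (^2^-distribʳ-* j L Q) ⟩
    L ^2^ j * Q ^2^ j * L        ≡⟨ ℤ.*-assoc (L ^2^ j) _ L ⟩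
    L ^2^ j * (Q ^2^ j * L)      ≤⟨ *-monoˡ-≤-nonNeg′ (^2^-nonNeg j 0≤L) (power-mean j xs (λ x → g x * g x)) ⟩
    L ^2^ j * (L ^2^ j * R)      ≡⟨ ℤ.*-assoc (L ^2^ j) _ R ⟨
    L ^2^ j * L ^2^ j * R        ≡⟨ cong (_* R) (^2^-distribʳ-* j L L) ⟨
    (L * L) ^2^ j * R            ∎
    where
    open ℤ.≤-Reasoning
    L = + length xs
    S = ∑ xs g
    Q = ∑[ x ∈ xs ] (g x * g x)
    R = ∑[ x ∈ xs ] (g x ^2^ suc j)
    0≤L : 0ℤ ℤ.≤ L
    0≤L = ℤ.+≤+ ℕ.z≤n

module _ {n : ℕ} where

  ⊕-comm : (x y : Cube n) → x ⊕ y ≡ y ⊕ x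
  ⊕-comm = Vec.zipWith-comm xor-comm

  ⊕-assoc : (x y z : Cube n) → (x ⊕ y) ⊕ z ≡ x ⊕ (y ⊕ z)
  ⊕-assoc = Vec.zipWith-assoc xor-assoc

  ⊕-identityʳ : (x : Cube n) → x ⊕ 𝟘 ≡ x
  ⊕-identityʳ = Vec.zipWith-identityʳ xor-identityʳ

  ⊕-swapʳ : (x y z : Cube n) → (x ⊕ y) ⊕ z ≡ (x ⊕ z) ⊕ y
  ⊕-swapʳ x y z = trans (⊕-assoc x y z) (trans (cong (x ⊕_) (⊕-comm y z)) (sym (⊕-assoc x z y)))

∑-vecsOf-suc : ∀ {A : Set} (C : List A) k (g : Vec A (suc k) → ℤ) →
  ∑ (vecsOf C (suc k)) g ≡ ∑[ a ∈ C ] ∑[ xs ∈ vecsOf C k ] g (a ∷ xs)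
∑-vecsOf-suc C k g = trans (∑-concatMap _ C g) (∑-cong C (λ a → ∑-map (a ∷_) (vecsOf C k) g))

∑-cube-suc : ∀ n (g : Cube (suc n) → ℤ) →
  ∑ (cube (suc n)) g ≡ ∑[ x ∈ cube n ] g (true ∷ x) + ∑[ x ∈ cube n ] g (false ∷ x)
∑-cube-suc n g = trans (∑-vecsOf-suc _ n g) (cong (_+_ (∑[ x ∈ cube n ] g (true ∷ x))) (ℤ.+-identityʳ _))

∑-translate : ∀ n (a : Cube n) (g : Cube n → ℤ) → ∑[ x ∈ cube n ] g (x ⊕ a) ≡ ∑ (cube n) g
∑-translate zero    []        g = cong (λ x → g x + 0ℤ) (⊕-identityʳ [])
∑-translate (suc n) (false ∷ a) g = begin
  ∑[ x ∈ cube (suc n) ] g (x ⊕ (false ∷ a))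
    ≡⟨ ∑-cube-suc n _ ⟩
  ∑[ x ∈ cube n ] g (true ∷ (x ⊕ a)) + ∑[ x ∈ cube n ] g (false ∷ (x ⊕ a))
    ≡⟨ cong₂ _+_ (∑-translate n a (g ∘ (true ∷_))) (∑-translate n a (g ∘ (false ∷_))) ⟩
  ∑[ x ∈ cube n ] g (true ∷ x) + ∑[ x ∈ cube n ] g (false ∷ x)
    ≡⟨ ∑-cube-suc n g ⟨
  ∑ (cube (suc n)) g ∎
  where open ≡-Reasoning
∑-translate (suc n) (true ∷ a) g = begin
  ∑[ x ∈ cube (suc n) ] g (x ⊕ (true ∷ a))
    ≡⟨ ∑-cube-suc n _ ⟩
  ∑[ x ∈ cube n ] g (false ∷ (x ⊕ a)) + ∑[ x ∈ cube n ] g (true ∷ (x ⊕ a))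
    ≡⟨ cong₂ _+_ (∑-translate n a (g ∘ (false ∷_))) (∑-translate n a (g ∘ (true ∷_))) ⟩
  ∑[ x ∈ cube n ] g (false ∷ x) + ∑[ x ∈ cube n ] g (true ∷ x)
    ≡⟨ ℤ.+-comm (∑[ x ∈ cube n ] g (false ∷ x)) _ ⟩
  ∑[ x ∈ cube n ] g (true ∷ x) + ∑[ x ∈ cube n ] g (false ∷ x)
    ≡⟨ ∑-cube-suc n g ⟨
  ∑ (cube (suc n)) g ∎
  where open ≡-Reasoning

∑-translateˡ : ∀ n (a : Cube n) (g : Cube n → ℤ) → ∑[ x ∈ cube n ] g (a ⊕ x) ≡ ∑ (cube n) g
∑-translateˡ n a g = trans (∑-cong (cube n) (λ x → cong g (⊕-comm a x))) (∑-translate n a g)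

∑-square : ∀ n (g : Cube n → ℤ) → ∑ (cube n) g * ∑ (cube n) g ≡ ∑[ x ∈ cube n ] ∑[ h ∈ cube n ] (g x * g (x ⊕ h))
∑-square n g = begin
  ∑ (cube n) g * ∑ (cube n) g                        ≡⟨ ∑-*ʳ (cube n) _ g ⟨
  ∑[ x ∈ cube n ] (g x * ∑ (cube n) g)               ≡⟨ ∑-cong (cube n) (λ x → cong (_*_ (g x)) (∑-translateˡ n x g)) ⟨
  ∑[ x ∈ cube n ] (g x * ∑[ h ∈ cube n ] g (x ⊕ h))  ≡⟨ ∑-cong (cube n) (λ x → ∑-*ˡ (cube n) (g x) _) ⟨
  ∑[ x ∈ cube n ] ∑[ h ∈ cube n ] (g x * g (x ⊕ h))  ∎
  where open ≡-Reasoning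

length-vecsOf : ∀ {A : Set} (C : List A) k → + length (vecsOf C k) ≡ (+ length C) ^ k
length-vecsOf C zero    = refl
length-vecsOf C (suc k) = begin
  + length (vecsOf C (suc k))                ≡⟨ ∑-1 (vecsOf C (suc k)) ⟨
  ∑[ xs ∈ vecsOf C (suc k) ] 1ℤ              ≡⟨ ∑-vecsOf-suc C k _ ⟩
  ∑[ a ∈ C ] ∑[ xs ∈ vecsOf C k ] 1ℤ         ≡⟨ ∑-cong C (λ _ → ∑-1 (vecsOf C k)) ⟩
  ∑[ a ∈ C ] (+ length (vecsOf C k))         ≡⟨ ∑-const C _ ⟩
  + length C * + length (vecsOf C k)         ≡⟨ cong (_*_ (+ length C)) (length-vecsOf C k) ⟩
  (+ length C) ^ suc k                       ∎
  where open ≡-Reasoning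

pos-^ : ∀ m k → + (m ℕ.^ k) ≡ (+ m) ^ k
pos-^ m zero    = refl
pos-^ m (suc k) = trans (ℤ.pos-* m (m ℕ.^ k)) (cong (_*_ (+ m)) (pos-^ m k))

#cube : ℕ → ℤ
#cube n = + length (cube n)

#cube≡2^ : ∀ n → #cube n ≡ (+ 2) ^ n
#cube≡2^ n = length-vecsOf _ n

#cube-pos : ∀ n → 0ℤ ℤ.< #cube n
#cube-pos n = subst (0ℤ ℤ.<_) (sym (#cube≡2^ n)) (^-pos n (ℤ.+<+ (ℕ.s≤s ℕ.z≤n)))

#cube-nonNeg : ∀ n → 0ℤ ℤ.≤ #cube n
#cube-nonNeg n = ℤ.+≤+ ℕ.z≤n

#tuples : ∀ n t → + length (tuples n t) ≡ #cube n ^ t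
#tuples n t = length-vecsOf (cube n) t

-- Gowers sums

Δ : ∀ {n} → (Cube n → ℤ) → Cube n → Cube n → ℤ
Δ F h z = F z * F (z ⊕ h)

-- gowersSum k F = 2^(n(k+1)) ‖F‖_{U_k}^(2^k), via ‖F‖_{U_{k+1}}^(2^(k+1)) = E_h ‖Δ F h‖_{U_k}^(2^k).
gowersSum : ∀ {n} → ℕ → (Cube n → ℤ) → ℤ
gowersSum {n} zero    F = ∑ (cube n) F
gowersSum {n} (suc k) F = ∑[ h ∈ cube n ] gowersSum k (Δ F h)

gowersSum-cong : ∀ {n} k {F G : Cube n → ℤ} → (∀ z → F z ≡ G z) → gowersSum k F ≡ gowersSum k G
gowersSum-cong {n} zero    F≗G = ∑-cong (cube n) F≗G
gowersSum-cong {n} (suc k) F≗G = ∑-cong (cube n) (λ h → gowersSum-cong k (λ z → cong₂ _*_ (F≗G z) (F≗G (z ⊕ h))))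

gowersSum-translate : ∀ {n} k (a : Cube n) (F : Cube n → ℤ) → gowersSum k (λ z → F (z ⊕ a)) ≡ gowersSum k F
gowersSum-translate {n} zero    a F = ∑-translate n a F
gowersSum-translate {n} (suc k) a F = ∑-cong (cube n) (λ h →
  trans (gowersSum-cong k (λ z → cong (λ w → F (z ⊕ a) * F w) (⊕-swapʳ z h a))) (gowersSum-translate k a (Δ F h)))

gowersSum-1 : ∀ {n} (F : Cube n → ℤ) → gowersSum 1 F ≡ ∑ (cube n) F * ∑ (cube n) F
gowersSum-1 {n} F = trans (∑-comm (cube n) (cube n) _) (sym (∑-square n F))

gowersSum-square : ∀ {n} k (F : Cube n → ℤ) → gowersSum k F * gowersSum k F ℤ.≤ #cube n ^ k * gowersSum (suc k) F
gowersSum-square {n} zero    F = ℤ.≤-reflexive (trans (sym (gowersSum-1 F)) (sym (ℤ.*-identityˡ _)))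
gowersSum-square {n} (suc k) F = begin
  ∑[ h ∈ cube n ] U h * ∑[ h ∈ cube n ] U h             ≤⟨ cauchy-schwarz (cube n) U ⟩
  #cube n * ∑[ h ∈ cube n ] (U h * U h)                 ≤⟨ *-monoˡ-≤-nonNeg′ (#cube-nonNeg n)
                                                             (∑-mono-≤ (cube n) (All.universal (λ h → gowersSum-square k (Δ F h)) _)) ⟩
  #cube n * ∑[ h ∈ cube n ] (#cube n ^ k * gowersSum (suc k) (Δ F h))
                                                        ≡⟨ cong (_*_ (#cube n)) (∑-*ˡ (cube n) (#cube n ^ k) _) ⟩
  #cube n * (#cube n ^ k * gowersSum (suc (suc k)) F)   ≡⟨ ℤ.*-assoc (#cube n) _ _ ⟨
  #cube n ^ suc k * gowersSum (suc (suc k)) F           ∎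
  where
  open ℤ.≤-Reasoning
  U : Cube n → ℤ
  U h = gowersSum k (Δ F h)

gowersSum-nonNeg : ∀ {n} k (F : Cube n → ℤ) → 0ℤ ℤ.≤ gowersSum (suc k) F
gowersSum-nonNeg {n} k F = *-cancelˡ-≤-pos′ (^-pos k (#cube-pos n))
  (subst (ℤ._≤ #cube n ^ k * gowersSum (suc k) F) (sym (ℤ.*-zeroʳ (#cube n ^ k)))
    (ℤ.≤-trans (square-nonNeg (gowersSum k F)) (gowersSum-square k F)))

foldr-allFin-suc : ∀ {B : Set} k (G : Fin (suc k) → B → B) z →
  foldr G z (List.allFin (suc k)) ≡ G Fin.zero (foldr (G ∘ Fin.suc) z (List.allFin k))
foldr-allFin-suc k G z =
  cong (G Fin.zero) (trans (cong (foldr G z) (sym (List.map-tabulate id Fin.suc))) (List.foldr-map G Fin.suc z (List.allFin k)))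

subsetSum′ : ∀ {n k} → Vec Bool k → Vec (Cube n) k → Cube n
subsetSum′ []          []       = 𝟘
subsetSum′ (true ∷ S)  (y ∷ ys) = y ⊕ subsetSum′ S ys
subsetSum′ (false ∷ S) (y ∷ ys) = subsetSum′ S ys

subsetSum-∷ : ∀ {n k} b (S : Vec Bool k) y (ys : Vec (Cube n) k) →
  subsetSum (b ∷ S) (y ∷ ys) ≡ (if b then y ⊕ subsetSum S ys else subsetSum S ys)
subsetSum-∷ {k = k} b S y ys = foldr-allFin-suc k (λ i acc → if lookup (b ∷ S) i then lookup (y ∷ ys) i ⊕ acc else acc) 𝟘

subsetSum≡subsetSum′ : ∀ {n k} (S : Vec Bool k) (ys : Vec (Cube n) k) → subsetSum S ys ≡ subsetSum′ S ys
subsetSum≡subsetSum′ []          []       = refl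
subsetSum≡subsetSum′ (true ∷ S)  (y ∷ ys) = trans (subsetSum-∷ true S y ys) (cong (y ⊕_) (subsetSum≡subsetSum′ S ys))
subsetSum≡subsetSum′ (false ∷ S) (y ∷ ys) = trans (subsetSum-∷ false S y ys) (subsetSum≡subsetSum′ S ys)

subsetSum′-update : ∀ {n t} (e : Vec Bool t) (xs : Vec (Cube n) t) j y → lookup e j ≡ false → subsetSum′ e (xs [ j ]≔ y) ≡ subsetSum′ e xs
subsetSum′-update (false ∷ e) (x ∷ xs) Fin.zero    y j∉e = refl
subsetSum′-update (true ∷ e)  (x ∷ xs) (Fin.suc j) y j∉e = cong (x ⊕_) (subsetSum′-update e xs j y j∉e)
subsetSum′-update (false ∷ e) (x ∷ xs) (Fin.suc j) y j∉e = subsetSum′-update e xs j y j∉e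

∏-cube-suc : ∀ k (g : Cube (suc k) → ℤ) → ∏ (cube (suc k)) g ≡ ∏[ S ∈ cube k ] g (true ∷ S) * ∏[ S ∈ cube k ] g (false ∷ S)
∏-cube-suc k g = begin
  ∏ (map (true ∷_) (cube k) ++ (map (false ∷_) (cube k) ++ [])) g
    ≡⟨ ∏-++ (map (true ∷_) (cube k)) _ g ⟩
  ∏ (map (true ∷_) (cube k)) g * ∏ (map (false ∷_) (cube k) ++ []) g
    ≡⟨ cong (_*_ (∏ (map (true ∷_) (cube k)) g)) (cong (λ xs → ∏ xs g) (List.++-identityʳ (map (false ∷_) (cube k)))) ⟩
  ∏ (map (true ∷_) (cube k)) g * ∏ (map (false ∷_) (cube k)) g
    ≡⟨ cong₂ _*_ (∏-map (true ∷_) (cube k) g) (∏-map (false ∷_) (cube k) g) ⟩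
  ∏[ S ∈ cube k ] g (true ∷ S) * ∏[ S ∈ cube k ] g (false ∷ S) ∎
  where open ≡-Reasoning

gowersSum-explicit : ∀ {n} k (F : Cube n → ℤ) →
  ∑[ x ∈ cube n ] ∑[ ys ∈ tuples n k ] ∏[ S ∈ cube k ] F (x ⊕ subsetSum′ S ys) ≡ gowersSum k F
gowersSum-explicit {n} zero    F = ∑-cong (cube n) (λ x → trans (ℤ.+-identityʳ _) (trans (ℤ.*-identityʳ _) (cong F (⊕-identityʳ x))))
gowersSum-explicit {n} (suc k) F = begin
  ∑[ x ∈ cube n ] ∑[ ys ∈ tuples n (suc k) ] ∏[ S ∈ cube (suc k) ] F (x ⊕ subsetSum′ S ys)
    ≡⟨ ∑-cong (cube n) (λ x → ∑-vecsOf-suc (cube n) k _) ⟩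
  ∑[ x ∈ cube n ] ∑[ y ∈ cube n ] ∑[ ys ∈ tuples n k ] ∏[ S ∈ cube (suc k) ] F (x ⊕ subsetSum′ S (y ∷ ys))
    ≡⟨ ∑-cong (cube n) (λ x → ∑-cong (cube n) (λ y → ∑-cong (tuples n k) (λ ys → split-first x y ys))) ⟩
  ∑[ x ∈ cube n ] ∑[ y ∈ cube n ] ∑[ ys ∈ tuples n k ] ∏[ S ∈ cube k ] Δ F y (x ⊕ subsetSum′ S ys)
    ≡⟨ ∑-comm (cube n) (cube n) _ ⟩
  ∑[ y ∈ cube n ] ∑[ x ∈ cube n ] ∑[ ys ∈ tuples n k ] ∏[ S ∈ cube k ] Δ F y (x ⊕ subsetSum′ S ys)
    ≡⟨ ∑-cong (cube n) (λ y → gowersSum-explicit k (Δ F y)) ⟩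
  gowersSum (suc k) F ∎
  where
  open ≡-Reasoning
  split-first : ∀ x y ys → ∏[ S ∈ cube (suc k) ] F (x ⊕ subsetSum′ S (y ∷ ys)) ≡ ∏[ S ∈ cube k ] Δ F y (x ⊕ subsetSum′ S ys)
  split-first x y ys = begin
    ∏[ S ∈ cube (suc k) ] F (x ⊕ subsetSum′ S (y ∷ ys))
      ≡⟨ ∏-cube-suc k _ ⟩
    ∏[ S ∈ cube k ] F (x ⊕ (y ⊕ subsetSum′ S ys)) * ∏[ S ∈ cube k ] F (x ⊕ subsetSum′ S ys)
      ≡⟨ ℤ.*-comm (∏[ S ∈ cube k ] F (x ⊕ (y ⊕ subsetSum′ S ys))) _ ⟩
    ∏[ S ∈ cube k ] F (x ⊕ subsetSum′ S ys) * ∏[ S ∈ cube k ] F (x ⊕ (y ⊕ subsetSum′ S ys))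
      ≡⟨ ∏-* (cube k) _ _ ⟨
    ∏[ S ∈ cube k ] (F (x ⊕ subsetSum′ S ys) * F (x ⊕ (y ⊕ subsetSum′ S ys)))
      ≡⟨ ∏-cong (cube k) (λ S → cong (λ w → F (x ⊕ subsetSum′ S ys) * F w) (reassoc (subsetSum′ S ys))) ⟩
    ∏[ S ∈ cube k ] Δ F y (x ⊕ subsetSum′ S ys) ∎
    where
    reassoc : ∀ s → x ⊕ (y ⊕ s) ≡ (x ⊕ s) ⊕ y
    reassoc s = trans (sym (⊕-assoc x y s)) (⊕-swapʳ x y s)

sumℤ≡∑ : ∀ xs → sumℤ xs ≡ ∑ xs id
sumℤ≡∑ []       = refl
sumℤ≡∑ (x ∷ xs) = cong (_+_ x) (sumℤ≡∑ xs)

prodℤ≡∏ : ∀ xs → prodℤ xs ≡ ∏ xs id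
prodℤ≡∏ []       = refl
prodℤ≡∏ (x ∷ xs) = cong (_*_ x) (prodℤ≡∏ xs)

gowersPow-numerator : ∀ {n} d (f : Cube n → ℤ) →
  sumℤ (concatMap (λ x → map (λ ys → prodℤ (map (λ S → f (x ⊕ subsetSum S ys)) (cube d))) (tuples n d)) (cube n))
    ≡ gowersSum d f
gowersPow-numerator {n} d f = begin
  sumℤ (concatMap (λ x → map (λ ys → P x ys) (tuples n d)) (cube n))
    ≡⟨ sumℤ≡∑ (concatMap (λ x → map (λ ys → P x ys) (tuples n d)) (cube n)) ⟩
  ∑ (concatMap (λ x → map (λ ys → P x ys) (tuples n d)) (cube n)) id
    ≡⟨ ∑-concatMap _ (cube n) id ⟩
  ∑[ x ∈ cube n ] ∑ (map (λ ys → P x ys) (tuples n d)) id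
    ≡⟨ ∑-cong (cube n) (λ x → trans (∑-map _ (tuples n d) id) (∑-cong (tuples n d) (λ ys → product x ys))) ⟩
  ∑[ x ∈ cube n ] ∑[ ys ∈ tuples n d ] ∏[ S ∈ cube d ] f (x ⊕ subsetSum′ S ys)
    ≡⟨ gowersSum-explicit d f ⟩
  gowersSum d f ∎
  where
  open ≡-Reasoning
  P : Cube n → Vec (Cube n) d → ℤ
  P x ys = prodℤ (map (λ S → f (x ⊕ subsetSum S ys)) (cube d))
  product : ∀ x ys → P x ys ≡ ∏[ S ∈ cube d ] f (x ⊕ subsetSum′ S ys)
  product x ys = trans (prodℤ≡∏ (map (λ S → f (x ⊕ subsetSum S ys)) (cube d))) (trans (∏-map (λ S → f (x ⊕ subsetSum S ys)) (cube d) id)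
    (∏-cong (cube d) (λ S → cong (λ s → f (x ⊕ s)) (subsetSum≡subsetSum′ S ys))))

infix 4 _÷_≤U[_]_

-- (X / Y)^(2^k) ≤ ‖F‖_{U_k}^(2^k), with all denominators cleared.
record _÷_≤U[_]_ {n} (X Y : ℤ) (k : ℕ) (F : Cube n → ℤ) : Set where
  constructor mk≤U
  field
    cleared : X ^2^ k * #cube n ^ suc k ℤ.≤ Y ^2^ k * gowersSum k F
open _÷_≤U[_]_

≤U-suc : ∀ {n} k {X Y} {F : Cube n → ℤ} → X ÷ Y ≤U[ suc k ] F → X ÷ Y ≤U[ suc (suc k) ] F
≤U-suc {n} k {X} {Y} {F} (mk≤U hyp) = mk≤U (*-cancelˡ-≤-pos′ (^-pos (suc k) (#cube-pos n)) (begin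
  P * ((X * X) ^2^ suc k * (N * (N * P)))   ≡⟨ cong (λ w → P * (w * (N * (N * P)))) (^2^-distribʳ-* (suc k) X X) ⟩
  P * (a * a * (N * (N * P)))               ≡⟨ rearrangeˡ a N P ⟩
  (a * (N * P)) * (a * (N * P))             ≤⟨ ^2^-mono-≤ 1 (*-nonNeg (^2^-suc-nonNeg k X) (^-nonNeg (suc (suc k)) (#cube-nonNeg n))) hyp ⟩
  (b * u) * (b * u)                         ≡⟨ ^2^-distribʳ-* 1 b u ⟩
  (b * b) * (u * u)                         ≤⟨ *-monoˡ-≤-nonNeg′ (square-nonNeg b) (gowersSum-square (suc k) F) ⟩
  (b * b) * (P * gowersSum (suc (suc k)) F) ≡⟨ rearrangeʳ (b * b) P _ ⟩
  P * ((b * b) * gowersSum (suc (suc k)) F) ≡⟨ cong (λ w → P * (w * gowersSum (suc (suc k)) F)) (^2^-distribʳ-* (suc k) Y Y) ⟨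
  P * ((Y * Y) ^2^ suc k * gowersSum (suc (suc k)) F) ∎))
  where
  open ℤ.≤-Reasoning
  N = #cube n
  P = N ^ suc k
  a = X ^2^ suc k
  b = Y ^2^ suc k
  u = gowersSum (suc k) F
  rearrangeˡ : ∀ a N P → P * (a * a * (N * (N * P))) ≡ (a * (N * P)) * (a * (N * P))
  rearrangeˡ = solve-∀
  rearrangeʳ : ∀ c P v → c * (P * v) ≡ P * (c * v)
  rearrangeʳ = solve-∀

≤U-mono : ∀ {n j k X Y} {F : Cube n → ℤ} → j ≤ k → X ÷ Y ≤U[ suc j ] F → X ÷ Y ≤U[ suc k ] F
≤U-mono {k = zero}  ℕ.z≤n hyp = hyp
≤U-mono {k = suc k} {X} {Y} {F} j≤1+k hyp with ℕ.m≤n⇒m<n∨m≡n j≤1+k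
... | inj₁ (ℕ.s≤s j≤k) = ≤U-suc k {X} {Y} {F} (≤U-mono {X = X} {Y} {F} j≤k hyp)
... | inj₂ refl        = hyp

≤U-mono-÷ : ∀ {n} k {X Y Y′} {F : Cube n → ℤ} → 0ℤ ℤ.≤ Y → Y ℤ.≤ Y′ → X ÷ Y ≤U[ suc k ] F → X ÷ Y′ ≤U[ suc k ] F
≤U-mono-÷ k {F = F} 0≤Y Y≤Y′ (mk≤U hyp) = mk≤U (
  ℤ.≤-trans hyp (*-monoʳ-≤-nonNeg′ (gowersSum-nonNeg k F) (^2^-mono-≤ (suc k) 0≤Y Y≤Y′)))

module _ {n : ℕ} {A : Set} where

  ∑-≤U : ∀ k xs (X : A → ℤ) {Y} {F : A → Cube n → ℤ} → All (λ i → X i ÷ Y ≤U[ k ] F i) xs →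
    ∑ xs X ^2^ k * (#cube n ^ suc k * + length xs) ℤ.≤ (+ length xs * Y) ^2^ k * ∑[ i ∈ xs ] gowersSum k (F i)
  ∑-≤U k xs X {Y} {F} bounds = begin
    ∑ xs X ^2^ k * (M * L)                  ≡⟨ swap-right (∑ xs X ^2^ k) M L ⟩
    ∑ xs X ^2^ k * L * M                    ≤⟨ *-monoʳ-≤-nonNeg′ 0≤M (power-mean k xs X) ⟩
    L ^2^ k * ∑[ i ∈ xs ] (X i ^2^ k) * M   ≡⟨ trans (ℤ.*-assoc (L ^2^ k) _ M) (cong (_*_ (L ^2^ k)) (sym (∑-*ʳ xs M _))) ⟩
    L ^2^ k * ∑[ i ∈ xs ] (X i ^2^ k * M)   ≤⟨ *-monoˡ-≤-nonNeg′ (^2^-nonNeg k 0≤L) (∑-mono-≤ xs (All.map cleared bounds)) ⟩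
    L ^2^ k * ∑[ i ∈ xs ] (Y ^2^ k * gowersSum k (F i))
                                            ≡⟨ cong (_*_ (L ^2^ k)) (∑-*ˡ xs (Y ^2^ k) _) ⟩
    L ^2^ k * (Y ^2^ k * ∑[ i ∈ xs ] gowersSum k (F i))
                                            ≡⟨ trans (cong (_* ∑[ i ∈ xs ] gowersSum k (F i)) (^2^-distribʳ-* k L Y)) (ℤ.*-assoc (L ^2^ k) _ _) ⟨
    (L * Y) ^2^ k * ∑[ i ∈ xs ] gowersSum k (F i) ∎
    where
    open ℤ.≤-Reasoning
    L = + length xs
    M = #cube n ^ suc k
    0≤L : 0ℤ ℤ.≤ L
    0≤L = ℤ.+≤+ ℕ.z≤n
    0≤M : 0ℤ ℤ.≤ M
    0≤M = ^-nonNeg (suc k) (#cube-nonNeg n)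
    swap-right : ∀ a b c → a * (b * c) ≡ a * c * b
    swap-right = solve-∀

  ∑-≤U-const : ∀ k xs (X : A → ℤ) {Y} {F : Cube n → ℤ} → 0ℤ ℤ.< + length xs → All (λ i → X i ÷ Y ≤U[ k ] F) xs →
    ∑ xs X ÷ + length xs * Y ≤U[ k ] F
  ∑-≤U-const k xs X {Y} {F} 0<L bounds = mk≤U (ℤ.*-cancelʳ-≤-pos _ _ (+ length xs) {{ℤ.positive 0<L}} (begin
    ∑ xs X ^2^ k * #cube n ^ suc k * L         ≡⟨ ℤ.*-assoc (∑ xs X ^2^ k) _ L ⟩
    ∑ xs X ^2^ k * (#cube n ^ suc k * L)       ≤⟨ ∑-≤U k xs X bounds ⟩
    (L * Y) ^2^ k * ∑[ i ∈ xs ] gowersSum k F  ≡⟨ cong (_*_ ((L * Y) ^2^ k)) (∑-const xs (gowersSum k F)) ⟩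
    (L * Y) ^2^ k * (L * gowersSum k F)        ≡⟨ move-L ((L * Y) ^2^ k) L (gowersSum k F) ⟩
    (L * Y) ^2^ k * gowersSum k F * L          ∎))
    where
    open ℤ.≤-Reasoning
    L = + length xs
    move-L : ∀ a l u → a * (l * u) ≡ a * u * l
    move-L = solve-∀

^2^-suc-≤-via-square : ∀ k {S T c M Z V} → 0ℤ ℤ.≤ c → 0ℤ ℤ.≤ M →
  S * S ℤ.≤ c * T → T ^2^ k * M ℤ.≤ Z ^2^ k * V → S ^2^ suc k * M ℤ.≤ (c * Z) ^2^ k * V
^2^-suc-≤-via-square k {S} {T} {c} {M} {Z} {V} 0≤c 0≤M S²≤cT T≤Z = begin
  (S * S) ^2^ k * M            ≤⟨ *-monoʳ-≤-nonNeg′ 0≤M (^2^-mono-≤ k (square-nonNeg S) S²≤cT) ⟩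
  (c * T) ^2^ k * M            ≡⟨ trans (cong (_* M) (^2^-distribʳ-* k c T)) (ℤ.*-assoc (c ^2^ k) _ M) ⟩
  c ^2^ k * (T ^2^ k * M)      ≤⟨ *-monoˡ-≤-nonNeg′ (^2^-nonNeg k 0≤c) T≤Z ⟩
  c ^2^ k * (Z ^2^ k * V)      ≡⟨ trans (cong (_* V) (^2^-distribʳ-* k c Z)) (ℤ.*-assoc (c ^2^ k) _ V) ⟨
  (c * Z) ^2^ k * V            ∎
  where open ℤ.≤-Reasoning

size≡0⇒lookup≢true : ∀ {t} (e : Vec Bool t) → size e ≡ 0 → ∀ j → lookup e j ≢ true
size≡0⇒lookup≢true (false ∷ e) |e| (Fin.suc j) = size≡0⇒lookup≢true e |e| j

size≡0⇒subsetSum′≡𝟘 : ∀ {n t} (e : Vec Bool t) → size e ≡ 0 → (xs : Vec (Cube n) t) → subsetSum′ e xs ≡ 𝟘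
size≡0⇒subsetSum′≡𝟘 []          |e| []       = refl
size≡0⇒subsetSum′≡𝟘 (false ∷ e) |e| (x ∷ xs) = size≡0⇒subsetSum′≡𝟘 e |e| xs

-- Gowers–Cauchy–Schwarz for forms with admissible factors

Tuple : ℕ → ℕ → Set
Tuple n t = Vec (Cube n) t

record Factor (n t : ℕ) : Set where
  constructor factor
  field
    index : Fin t
    value : Tuple n t → ℤ
open Factor

-- Cauchy–Schwarz in the variable x_j removes an admissible factor of index j.
record Admissible {n t} (e : Vec Bool t) (φ : Factor n t) : Set where
  field
    index∈e             : lookup e (index φ) ≡ true
    value²≡1            : ∀ xs → value φ xs * value φ xs ≡ 1ℤ
    value-ignores-index : ∀ xs y → value φ (xs [ index φ ]≔ y) ≡ value φ xs
open Admissible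

weight : ∀ {n t} → List (Factor n t) → Tuple n t → ℤ
weight B xs = ∏[ φ ∈ B ] value φ xs

form : ∀ {n t} → Vec Bool t → (Cube n → ℤ) → List (Factor n t) → ℤ
form {n} {t} e F B = ∑[ xs ∈ tuples n t ] (F (subsetSum′ e xs) * weight B xs)

module _ {n t : ℕ} where

  slice : Cube n → List (Factor n (suc t)) → List (Factor n t)
  slice x₀ []                             = []
  slice x₀ (factor Fin.zero    b ∷ B) = slice x₀ B
  slice x₀ (factor (Fin.suc j) b ∷ B) = factor j (λ xs → b (x₀ ∷ xs)) ∷ slice x₀ B

  -- Admissible factors of index 0 ignore the first variable, so evaluating them at 𝟘 loses nothing.
  weight₀ : List (Factor n (suc t)) → Tuple n t → ℤ
  weight₀ []                             xs = 1ℤ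
  weight₀ (factor Fin.zero    b ∷ B) xs = b (𝟘 ∷ xs) * weight₀ B xs
  weight₀ (factor (Fin.suc j) b ∷ B) xs = weight₀ B xs

  module _ {c : Bool} {e : Vec Bool t} where

    weight-∷ : ∀ {B} → All (Admissible (c ∷ e)) B → ∀ x₀ xs → weight B (x₀ ∷ xs) ≡ weight₀ B xs * weight (slice x₀ B) xs
    weight-∷ {[]}                         All.[]         x₀ xs = refl
    weight-∷ {factor Fin.zero b ∷ B}    (adm All.∷ adms) x₀ xs = trans
      (cong₂ _*_ (sym (value-ignores-index adm (x₀ ∷ xs) 𝟘)) (weight-∷ adms x₀ xs)) (sym (ℤ.*-assoc (b (𝟘 ∷ xs)) _ _))
    weight-∷ {factor (Fin.suc j) b ∷ B} (adm All.∷ adms) x₀ xs = trans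
      (cong (_*_ (b (x₀ ∷ xs))) (weight-∷ adms x₀ xs)) (*-left-comm (b (x₀ ∷ xs)) (weight₀ B xs) (weight (slice x₀ B) xs))

    weight₀-square : ∀ {B} → All (Admissible (c ∷ e)) B → ∀ xs → weight₀ B xs * weight₀ B xs ≡ 1ℤ
    weight₀-square {[]}                         All.[]         xs = refl
    weight₀-square {factor Fin.zero b ∷ B}    (adm All.∷ adms) xs =
      trans (*-interchange (b (𝟘 ∷ xs)) _ _ _) (cong₂ _*_ (value²≡1 adm (𝟘 ∷ xs)) (weight₀-square adms xs))
    weight₀-square {factor (Fin.suc j) b ∷ B} (adm All.∷ adms) xs = weight₀-square adms xs

    slice-admissible : ∀ {B} x₀ → All (Admissible (c ∷ e)) B → All (Admissible e) (slice x₀ B)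
    slice-admissible {[]}                         x₀ All.[]           = All.[]
    slice-admissible {factor Fin.zero b ∷ B}    x₀ (adm All.∷ adms) = slice-admissible x₀ adms
    slice-admissible {factor (Fin.suc j) b ∷ B} x₀ (adm All.∷ adms) = record
      { index∈e             = index∈e adm
      ; value²≡1            = λ xs → value²≡1 adm (x₀ ∷ xs)
      ; value-ignores-index = λ xs y → value-ignores-index adm (x₀ ∷ xs) y
      } All.∷ slice-admissible x₀ adms

  weight₀-false : ∀ {e : Vec Bool t} {B} → All (Admissible (false ∷ e)) B → ∀ xs → weight₀ B xs ≡ 1ℤ
  weight₀-false {B = []}                         All.[]         xs = refl
  weight₀-false {B = factor Fin.zero b ∷ B}    (adm All.∷ adms) xs with () ← index∈e adm
  weight₀-false {B = factor (Fin.suc j) b ∷ B} (adm All.∷ adms) xs = weight₀-false adms xs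

  form-false : ∀ (e : Vec Bool t) F {B} → All (Admissible (false ∷ e)) B →
    form (false ∷ e) F B ≡ ∑[ x₀ ∈ cube n ] form e F (slice x₀ B)
  form-false e F {B} adms = trans (∑-vecsOf-suc (cube n) t _) (∑-cong (cube n) (λ x₀ → ∑-cong (tuples n t) (λ xs →
    cong (_*_ (F (subsetSum′ e xs))) (trans (weight-∷ adms x₀ xs)
      (trans (cong (_* weight (slice x₀ B) xs) (weight₀-false adms xs)) (ℤ.*-identityˡ _))))))

  form-cauchy-schwarz : ∀ (e : Vec Bool t) F {B} → All (Admissible (true ∷ e)) B →
    form (true ∷ e) F B * form (true ∷ e) F B ℤ.≤
      #cube n ^ t * ∑[ h ∈ cube n ] ∑[ x₀ ∈ cube n ] form e (λ z → Δ F h (x₀ ⊕ z)) (slice x₀ B ++ slice (x₀ ⊕ h) B)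
  form-cauchy-schwarz e F {B} adms = begin
    S * S
      ≡⟨ cong (λ w → w * w) pull-out-weight₀ ⟩
    ∑[ xs ∈ tuples n t ] (weight₀ B xs * a xs) * ∑[ xs ∈ tuples n t ] (weight₀ B xs * a xs)
      ≤⟨ cauchy-schwarz (tuples n t) _ ⟩
    + length (tuples n t) * ∑[ xs ∈ tuples n t ] ((weight₀ B xs * a xs) * (weight₀ B xs * a xs))
      ≡⟨ cong₂ _*_ (#tuples n t) (∑-cong (tuples n t) drop-weight₀) ⟩
    #cube n ^ t * ∑[ xs ∈ tuples n t ] (a xs * a xs)
      ≡⟨ cong (_*_ (#cube n ^ t)) expand-squares ⟩
    #cube n ^ t * ∑[ h ∈ cube n ] ∑[ x₀ ∈ cube n ] I h x₀ ∎
    where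
    open ℤ.≤-Reasoning
    S = form (true ∷ e) F B
    s : Tuple n t → Cube n
    s = subsetSum′ e
    term : Tuple n t → Cube n → ℤ
    term xs x₀ = F (x₀ ⊕ s xs) * weight (slice x₀ B) xs
    a : Tuple n t → ℤ
    a xs = ∑ (cube n) (term xs)
    I : Cube n → Cube n → ℤ
    I h x₀ = form e (λ z → Δ F h (x₀ ⊕ z)) (slice x₀ B ++ slice (x₀ ⊕ h) B)
    pull-out-weight₀ : S ≡ ∑[ xs ∈ tuples n t ] (weight₀ B xs * a xs)
    pull-out-weight₀ = begin-equality
      S
        ≡⟨ ∑-vecsOf-suc (cube n) t _ ⟩
      ∑[ x₀ ∈ cube n ] ∑[ xs ∈ tuples n t ] (F (x₀ ⊕ s xs) * weight B (x₀ ∷ xs))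
        ≡⟨ ∑-cong (cube n) (λ x₀ → ∑-cong (tuples n t) (λ xs →
             trans (cong (_*_ (F (x₀ ⊕ s xs))) (weight-∷ adms x₀ xs)) (*-left-comm (F (x₀ ⊕ s xs)) (weight₀ B xs) _))) ⟩
      ∑[ x₀ ∈ cube n ] ∑[ xs ∈ tuples n t ] (weight₀ B xs * term xs x₀)
        ≡⟨ ∑-comm (cube n) (tuples n t) _ ⟩
      ∑[ xs ∈ tuples n t ] ∑[ x₀ ∈ cube n ] (weight₀ B xs * term xs x₀)
        ≡⟨ ∑-cong (tuples n t) (λ xs → ∑-*ˡ (cube n) (weight₀ B xs) (term xs)) ⟩
      ∑[ xs ∈ tuples n t ] (weight₀ B xs * a xs) ∎
    drop-weight₀ : ∀ xs → (weight₀ B xs * a xs) * (weight₀ B xs * a xs) ≡ a xs * a xs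
    drop-weight₀ xs = trans (*-interchange (weight₀ B xs) (a xs) _ _)
      (trans (cong (_* (a xs * a xs)) (weight₀-square adms xs)) (ℤ.*-identityˡ _))
    merge : ∀ xs x₀ h → term xs x₀ * term xs (x₀ ⊕ h) ≡ Δ F h (x₀ ⊕ s xs) * weight (slice x₀ B ++ slice (x₀ ⊕ h) B) xs
    merge xs x₀ h = trans (*-interchange (F (x₀ ⊕ s xs)) _ _ _)
      (cong₂ _*_ (cong (λ w → F (x₀ ⊕ s xs) * F w) (⊕-swapʳ x₀ h (s xs))) (sym (∏-++ (slice x₀ B) _ (λ φ → value φ xs))))
    expand-squares : ∑[ xs ∈ tuples n t ] (a xs * a xs) ≡ ∑[ h ∈ cube n ] ∑[ x₀ ∈ cube n ] I h x₀
    expand-squares = begin-equality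
      ∑[ xs ∈ tuples n t ] (a xs * a xs)
        ≡⟨ ∑-cong (tuples n t) (λ xs → trans (∑-square n (term xs)) (∑-cong (cube n) (λ x₀ → ∑-cong (cube n) (merge xs x₀)))) ⟩
      ∑[ xs ∈ tuples n t ] ∑[ x₀ ∈ cube n ] ∑[ h ∈ cube n ] (Δ F h (x₀ ⊕ s xs) * weight (slice x₀ B ++ slice (x₀ ⊕ h) B) xs)
        ≡⟨ trans (∑-comm (tuples n t) (cube n) _) (∑-cong (cube n) (λ x₀ → ∑-comm (tuples n t) (cube n) _)) ⟩
      ∑[ x₀ ∈ cube n ] ∑[ h ∈ cube n ] ∑[ xs ∈ tuples n t ] (Δ F h (x₀ ⊕ s xs) * weight (slice x₀ B ++ slice (x₀ ⊕ h) B) xs)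
        ≡⟨ ∑-comm (cube n) (cube n) _ ⟩
      ∑[ h ∈ cube n ] ∑[ x₀ ∈ cube n ] I h x₀ ∎

  form-size≡0 : ∀ (e : Vec Bool t) F {B} → size e ≡ 0 → All (Admissible e) B → form e F B ≡ #cube n ^ t * F 𝟘
  form-size≡0 e F {[]}    |e| All.[]         = begin
    ∑[ xs ∈ tuples n t ] (F (subsetSum′ e xs) * 1ℤ) ≡⟨ ∑-cong (tuples n t) (λ xs →
                                                       trans (ℤ.*-identityʳ _) (cong F (size≡0⇒subsetSum′≡𝟘 e |e| xs))) ⟩
    ∑[ xs ∈ tuples n t ] F 𝟘                         ≡⟨ ∑-const (tuples n t) (F 𝟘) ⟩
    + length (tuples n t) * F 𝟘                      ≡⟨ cong (_* F 𝟘) (#tuples n t) ⟩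
    #cube n ^ t * F 𝟘                                ∎
    where open ≡-Reasoning
  form-size≡0 e F {φ ∷ B} |e| (adm All.∷ _) = ⊥-elim (size≡0⇒lookup≢true e |e| (index φ) (index∈e adm))

≤U-translateˡ : ∀ {n} k {X Y} (a : Cube n) {G : Cube n → ℤ} → X ÷ Y ≤U[ k ] (λ z → G (a ⊕ z)) → X ÷ Y ≤U[ k ] G
≤U-translateˡ {n} k {X} {Y} a {G} (mk≤U hyp) = mk≤U (subst (λ u → X ^2^ k * #cube n ^ suc k ℤ.≤ Y ^2^ k * u)
  (trans (gowersSum-cong k (λ z → cong G (⊕-comm a z))) (gowersSum-translate k a G)) hyp)

module _ {n t : ℕ} (e : Vec Bool t) (F : Cube n → ℤ) {B : List (Factor n (suc t))} where

  form-≤U-false : ∀ q → All (Admissible (false ∷ e)) B →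
    (∀ {B′} → All (Admissible e) B′ → form e F B′ ÷ #cube n ^ t ≤U[ suc q ] F) →
    form (false ∷ e) F B ÷ #cube n ^ suc t ≤U[ suc q ] F
  form-≤U-false q adms ≤U-e = subst (λ S → S ÷ #cube n ^ suc t ≤U[ suc q ] F) (sym (form-false e F adms))
    (∑-≤U-const (suc q) (cube n) (λ x₀ → form e F (slice x₀ B)) (#cube-pos n)
      (All.universal (λ x₀ → ≤U-e (slice-admissible x₀ adms)) (cube n)))

  form-≤U-single : size e ≡ 0 → All (Admissible (true ∷ e)) B → form (true ∷ e) F B ÷ #cube n ^ suc t ≤U[ 1 ] F
  form-≤U-single |e|≡0 adms = mk≤U (begin
    S ^2^ 1 * N ^ 2                            ≤⟨ ^2^-suc-≤-via-square 0 {S} {T} {N ^ t} {N ^ 2} {N ^ 2 * N ^ t} {gowersSum 1 F}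
                                                    (^-nonNeg t (#cube-nonNeg n)) (^-nonNeg 2 (#cube-nonNeg n))
                                                    (form-cauchy-schwarz e F adms) (ℤ.≤-reflexive T-value) ⟩
    (N ^ t * (N ^ 2 * N ^ t)) * gowersSum 1 F  ≡⟨ cong (_* gowersSum 1 F) (square-shape N (N ^ t)) ⟩
    (N ^ suc t) ^2^ 1 * gowersSum 1 F          ∎)
    where
    open ℤ.≤-Reasoning
    N = #cube n
    S = form (true ∷ e) F B
    T = ∑[ h ∈ cube n ] ∑[ x₀ ∈ cube n ] form e (λ z → Δ F h (x₀ ⊕ z)) (slice x₀ B ++ slice (x₀ ⊕ h) B)
    square-shape : ∀ N P → P * (N * (N * 1ℤ) * P) ≡ (N * P) * (N * P)
    square-shape = solve-∀
    T-value : T * N ^ 2 ≡ N ^ 2 * N ^ t * gowersSum 1 F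
    T-value = begin-equality
      T * N ^ 2
        ≡⟨ cong (_* N ^ 2) (∑-cong (cube n) (λ h → ∑-cong (cube n) (λ x₀ →
             trans (form-size≡0 e (λ z → Δ F h (x₀ ⊕ z)) |e|≡0 (All.++⁺ (slice-admissible x₀ adms) (slice-admissible (x₀ ⊕ h) adms)))
                   (cong (λ z → N ^ t * Δ F h z) (⊕-identityʳ x₀))))) ⟩
      ∑[ h ∈ cube n ] ∑[ x₀ ∈ cube n ] (N ^ t * Δ F h x₀) * N ^ 2
        ≡⟨ cong (_* N ^ 2) (trans (∑-cong (cube n) (λ h → ∑-*ˡ (cube n) (N ^ t) (Δ F h))) (∑-*ˡ (cube n) (N ^ t) _)) ⟩
      N ^ t * gowersSum 1 F * N ^ 2
        ≡⟨ trans (*-right-comm (N ^ t) (gowersSum 1 F) (N ^ 2)) (cong (_* gowersSum 1 F) (ℤ.*-comm (N ^ t) (N ^ 2))) ⟩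
      N ^ 2 * N ^ t * gowersSum 1 F ∎

  form-≤U-true : ∀ k → All (Admissible (true ∷ e)) B →
    (∀ G {B′} → All (Admissible e) B′ → form e G B′ ÷ #cube n ^ t ≤U[ k ] G) →
    form (true ∷ e) F B ÷ #cube n ^ suc t ≤U[ suc k ] F
  form-≤U-true k adms ≤U-e = mk≤U (begin
    S ^2^ suc k * N ^ suc (suc k)   ≡⟨ cong (_*_ (S ^2^ suc k)) (ℤ.*-comm N (N ^ suc k)) ⟩
    S ^2^ suc k * (N ^ suc k * N)   ≤⟨ ^2^-suc-≤-via-square k {S} {T} {N ^ t} {N ^ suc k * N} {N * (N * N ^ t)} {gowersSum (suc k) F}
                                         (^-nonNeg t (#cube-nonNeg n)) (*-nonNeg (^-nonNeg (suc k) (#cube-nonNeg n)) (#cube-nonNeg n))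
                                         (form-cauchy-schwarz e F adms) T-bound ⟩
    (N ^ t * (N * (N * N ^ t))) ^2^ k * gowersSum (suc k) F
                                    ≡⟨ cong (λ z → z ^2^ k * gowersSum (suc k) F) (square-shape N (N ^ t)) ⟩
    (N ^ suc t) ^2^ suc k * gowersSum (suc k) F ∎)
    where
    open ℤ.≤-Reasoning
    N = #cube n
    S = form (true ∷ e) F B
    square-shape : ∀ N P → P * (N * (N * P)) ≡ (N * P) * (N * P)
    square-shape = solve-∀
    I : Cube n → Cube n → ℤ
    I h x₀ = form e (λ z → Δ F h (x₀ ⊕ z)) (slice x₀ B ++ slice (x₀ ⊕ h) B)
    T = ∑[ h ∈ cube n ] ∑ (cube n) (I h)
    I-bound : ∀ h x₀ → I h x₀ ÷ N ^ t ≤U[ k ] Δ F h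
    I-bound h x₀ = ≤U-translateˡ k x₀ (≤U-e _ (All.++⁺ (slice-admissible x₀ adms) (slice-admissible (x₀ ⊕ h) adms)))
    T-bound : T ^2^ k * (N ^ suc k * N) ℤ.≤ (N * (N * N ^ t)) ^2^ k * gowersSum (suc k) F
    T-bound = ∑-≤U k (cube n) (λ h → ∑ (cube n) (I h)) (All.universal (λ h →
      ∑-≤U-const k (cube n) (I h) (#cube-pos n) (All.universal (I-bound h) (cube n))) (cube n))

gowers-cauchy-schwarz : ∀ {n t} (e : Vec Bool t) q → size e ≡ suc q → (F : Cube n → ℤ) {B : List (Factor n t)} →
  All (Admissible e) B → form e F B ÷ #cube n ^ t ≤U[ suc q ] F
gowers-cauchy-schwarz (false ∷ e) q       |e|≡1+q F adms =
  form-≤U-false e F q adms (gowers-cauchy-schwarz e q |e|≡1+q F)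
gowers-cauchy-schwarz (true ∷ e)  zero    |e|≡1+q F adms = form-≤U-single e F (ℕ.suc-injective |e|≡1+q) adms
gowers-cauchy-schwarz (true ∷ e)  (suc q) |e|≡1+q F adms =
  form-≤U-true e F (suc q) adms (gowers-cauchy-schwarz e q (ℕ.suc-injective |e|≡1+q))

-- The hypergraph test

Sign : ℤ → Set
Sign x = x ≡ + 1 ⊎ x ≡ - + 1

Sign-square : ∀ {x} → Sign x → x * x ≡ 1ℤ
Sign-square (inj₁ refl) = refl
Sign-square (inj₂ refl) = refl

Sign-* : ∀ {x y} → Sign x → Sign y → Sign (x * y)
Sign-* (inj₁ refl) (inj₁ refl) = inj₁ refl
Sign-* (inj₁ refl) (inj₂ refl) = inj₂ refl
Sign-* (inj₂ refl) (inj₁ refl) = inj₂ refl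
Sign-* (inj₂ refl) (inj₂ refl) = inj₁ refl

Sign-^ : ∀ {x} k → Sign x → Sign (x ^ k)
Sign-^ zero    _ = inj₁ refl
Sign-^ (suc k) s = Sign-* s (Sign-^ k s)

1+c*c≡2 : ∀ {c} → Sign c → 1ℤ + c * c ≡ + 2
1+c*c≡2 (inj₁ refl) = refl
1+c*c≡2 (inj₂ refl) = refl

1+c*g≡0 : ∀ {c g} → Sign c → Sign g → g ≢ c → 1ℤ + c * g ≡ 0ℤ
1+c*g≡0 (inj₁ refl) (inj₁ refl) g≢c = ⊥-elim (g≢c refl)
1+c*g≡0 (inj₁ refl) (inj₂ refl) g≢c = refl
1+c*g≡0 (inj₂ refl) (inj₁ refl) g≢c = refl
1+c*g≡0 (inj₂ refl) (inj₂ refl) g≢c = ⊥-elim (g≢c refl)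

infix 4 _⊈_

_⊈_ : ∀ {t} → Vec Bool t → Vec Bool t → Set
_⊈_ {t} e₀ e = Σ (Fin t) λ j → lookup e₀ j ≡ true × lookup e j ≡ false

some-vertex : ∀ {t} (e : Vec Bool t) → 1 ≤ size e → Σ (Fin t) λ j → lookup e j ≡ true
some-vertex (true ∷ e)  _       = Fin.zero , refl
some-vertex (false ∷ e) 1≤|e| = Product.map Fin.suc id (some-vertex e 1≤|e|)

two-vertices : ∀ {t} (e : Vec Bool t) → 2 ≤ size e →
  Σ (Fin t) λ a → Σ (Fin t) λ b → lookup e a ≡ true × lookup e b ≡ true × a ≢ b
two-vertices (true ∷ e) (ℕ.s≤s 1≤|e|) with some-vertex e 1≤|e|
... | j , j∈e = Fin.zero , Fin.suc j , refl , j∈e , λ ()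
two-vertices (false ∷ e) 2≤|e| with two-vertices e 2≤|e|
... | a , b , a∈e , b∈e , a≢b = Fin.suc a , Fin.suc b , a∈e , b∈e , a≢b ∘ Fin.suc-injective

≢∧size≤⇒⊈ : ∀ {t} {e₀ e : Vec Bool t} → e ≢ e₀ → size e ≤ size e₀ → e₀ ⊈ e
≢∧size≤⇒⊈ {e₀ = []}          {[]}         e≢e₀ _ = ⊥-elim (e≢e₀ refl)
≢∧size≤⇒⊈ {e₀ = true ∷ e₀}  {false ∷ e} _    _ = Fin.zero , refl , refl
≢∧size≤⇒⊈ {e₀ = true ∷ e₀}  {true ∷ e}  e≢e₀ (ℕ.s≤s ≤) =
  Product.map Fin.suc id (≢∧size≤⇒⊈ {e₀ = e₀} {e} (e≢e₀ ∘ cong (true ∷_)) ≤)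
≢∧size≤⇒⊈ {e₀ = false ∷ e₀} {false ∷ e} e≢e₀ ≤ =
  Product.map Fin.suc id (≢∧size≤⇒⊈ {e₀ = e₀} {e} (e≢e₀ ∘ cong (false ∷_)) ≤)
≢∧size≤⇒⊈ {e₀ = false ∷ e₀} {true ∷ e}  _    < =
  Product.map Fin.suc id (≢∧size≤⇒⊈ {e₀ = e₀} {e} (λ e≡e₀ → ℕ.<-irrefl (cong size e≡e₀) <) (ℕ.<⇒≤ <))

module _ {A : Set} where

  maximal-split : (μ : A → ℕ) (x : A) (xs : List A) →
    Σ A λ x₀ → Σ (List A) λ G₁ → Σ (List A) λ G₂ → x ∷ xs ≡ G₁ ++ x₀ ∷ G₂ × All (λ y → μ y ≤ μ x₀) (x ∷ xs)
  maximal-split μ x []       = x , [] , [] , refl , ℕ.≤-refl All.∷ All.[]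
  maximal-split μ x (y ∷ xs) with maximal-split μ y xs
  ... | x₀ , G₁ , G₂ , eq , ≤μx₀ with μ x ℕ.≤? μ x₀
  ...   | yes μx≤μx₀ = x₀ , x ∷ G₁ , G₂ , cong (x ∷_) eq , μx≤μx₀ All.∷ ≤μx₀
  ...   | no  μx≰μx₀ = x , [] , y ∷ xs , refl ,
          ℕ.≤-refl All.∷ All.map (λ ≤μx₀ → ℕ.≤-trans ≤μx₀ (ℕ.<⇒≤ (ℕ.≰⇒> μx≰μx₀))) ≤μx₀

  All-++-∷ : ∀ {P : A → Set} G₁ {x G₂} → All P (G₁ ++ x ∷ G₂) → P x × All P (G₁ ++ G₂)
  All-++-∷ []       (px All.∷ pG₂)  = px , pG₂
  All-++-∷ (y ∷ G₁) (py All.∷ pG)   = Product.map₂ (py All.∷_) (All-++-∷ G₁ pG)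

  Unique-++-∷ : ∀ G₁ {x : A} {G₂} → Unique (G₁ ++ x ∷ G₂) → All (_≢ x) (G₁ ++ G₂)
  Unique-++-∷ []       (x≢G₂ AllPairs.∷ _) = All.map (λ x≢y y≡x → x≢y (sym y≡x)) x≢G₂
  Unique-++-∷ (y ∷ G₁) (y≢G AllPairs.∷ u)  = proj₁ (All-++-∷ G₁ y≢G) All.∷ Unique-++-∷ G₁ u

  Unique-resp-⊇ : ∀ {xs ys : List A} → xs ⊆ ys → Unique ys → Unique xs
  Unique-resp-⊇ Sublist.[]               AllPairs.[]             = AllPairs.[]
  Unique-resp-⊇ (y ∷ʳ xs⊆ys)             (_ AllPairs.∷ u)        = Unique-resp-⊇ xs⊆ys u
  Unique-resp-⊇ (refl Sublist.∷ xs⊆ys) (x≢ys AllPairs.∷ u) = All-resp-⊆ xs⊆ys x≢ys AllPairs.∷ Unique-resp-⊇ xs⊆ys u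

  nonemptySublists : List A → List (List A)
  nonemptySublists []       = []
  nonemptySublists (x ∷ xs) = (x ∷ []) ∷ map (x ∷_) (nonemptySublists xs) ++ nonemptySublists xs

  nonemptySublists-⊆ : ∀ xs → All (λ F → F ⊆ xs × F ≢ []) (nonemptySublists xs)
  nonemptySublists-⊆ []       = All.[]
  nonemptySublists-⊆ (x ∷ xs) = (refl Sublist.∷ Sublist.minimum xs , λ ()) All.∷ All.++⁺
    (All.map⁺ (All.map (λ (F⊆xs , _) → refl Sublist.∷ F⊆xs , λ ()) (nonemptySublists-⊆ xs)))
    (All.map (Product.map₁ (x ∷ʳ_)) (nonemptySublists-⊆ xs))

  length-nonemptySublists : ∀ xs → suc (length (nonemptySublists xs)) ≡ 2 ℕ.^ length xs
  length-nonemptySublists []       = refl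
  length-nonemptySublists (x ∷ xs) = begin
    suc (suc (length (map (x ∷_) S ++ S)))   ≡⟨ cong (suc ∘ suc) (trans (List.length-++ (map (x ∷_) S))
                                                   (cong (ℕ._+ length S) (List.length-map (x ∷_) S))) ⟩
    suc (suc (length S ℕ.+ length S))        ≡⟨ cong suc (ℕ.+-suc (length S) (length S)) ⟨
    suc (length S) ℕ.+ suc (length S)        ≡⟨ cong₂ ℕ._+_ (length-nonemptySublists xs)
                                                   (trans (length-nonemptySublists xs) (sym (ℕ.+-identityʳ _))) ⟩
    2 ℕ.^ suc (length xs)                    ∎
    where
    open ≡-Reasoning
    S = nonemptySublists xs

  ∏-1+ : ∀ xs (α : A → ℤ) → ∏[ x ∈ xs ] (1ℤ + α x) ≡ 1ℤ + ∑[ F ∈ nonemptySublists xs ] ∏ F α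
  ∏-1+ []       α = refl
  ∏-1+ (x ∷ xs) α = begin
    (1ℤ + α x) * ∏[ y ∈ xs ] (1ℤ + α y)                   ≡⟨ cong (_*_ (1ℤ + α x)) (∏-1+ xs α) ⟩
    (1ℤ + α x) * (1ℤ + R)                                 ≡⟨ expand (α x) R ⟩
    1ℤ + (α x * 1ℤ + (α x * R + R))                       ≡⟨ cong (λ w → 1ℤ + (α x * 1ℤ + (w + R))) with-x ⟨
    1ℤ + (α x * 1ℤ + (∑ (map (x ∷_) S) (λ F → ∏ F α) + R)) ≡⟨ cong (λ w → 1ℤ + (α x * 1ℤ + w)) (∑-++ (map (x ∷_) S) S _) ⟨
    1ℤ + ∑[ F ∈ nonemptySublists (x ∷ xs) ] ∏ F α        ∎
    where
    open ≡-Reasoning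
    S = nonemptySublists xs
    R = ∑[ F ∈ S ] ∏ F α
    with-x : ∑ (map (x ∷_) S) (λ F → ∏ F α) ≡ α x * R
    with-x = trans (∑-map (x ∷_) S _) (∑-*ˡ S (α x) _)
    expand : ∀ a r → (1ℤ + a) * (1ℤ + r) ≡ 1ℤ + (a * 1ℤ + (a * r + r))
    expand = solve-∀

module _ {n t : ℕ} (f : Cube n → ℤ) where

  productOn : Vec Bool t → Tuple n t → List (Fin t) → ℤ
  productOn e xs = foldr (λ i acc → if lookup e i then f (lookup xs i) * acc else acc) 1ℤ

  edgeConstant : Vec Bool t → ℤ
  edgeConstant e = f 𝟘 ^ suc (size e)

  edgeValue : Vec Bool t → Tuple n t → ℤ
  edgeValue e xs = subsetProd f e xs * f (subsetSum e xs)

  edgeTerm : Vec Bool t → Tuple n t → ℤ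
  edgeTerm e xs = edgeConstant e * edgeValue e xs

  module _ (±f : ∀ x → Sign (f x)) where

    Sign-productOn : ∀ e xs is → Sign (productOn e xs is)
    Sign-productOn e xs []       = inj₁ refl
    Sign-productOn e xs (i ∷ is) with lookup e i
    ... | true  = Sign-* (±f (lookup xs i)) (Sign-productOn e xs is)
    ... | false = Sign-productOn e xs is

    Sign-edgeValue : ∀ e xs → Sign (edgeValue e xs)
    Sign-edgeValue e xs = Sign-* (Sign-productOn e xs (List.allFin t)) (±f (subsetSum e xs))

    Sign-edgeConstant : ∀ e → Sign (edgeConstant e)
    Sign-edgeConstant e = Sign-^ (suc (size e)) (±f 𝟘)

    module _ (e₀ : Vec Bool t) {a b : Fin t} (a∈e₀ : lookup e₀ a ≡ true) (b∈e₀ : lookup e₀ b ≡ true) (a≢b : a ≢ b) where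

      -- The factor f(x_i) is attached to a vertex of e₀ other than i.
      partner : Fin t → Fin t
      partner i with i Fin.≟ a
      ... | yes _ = b
      ... | no  _ = a

      partner∈e₀ : ∀ i → lookup e₀ (partner i) ≡ true
      partner∈e₀ i with i Fin.≟ a
      ... | yes _ = b∈e₀
      ... | no  _ = a∈e₀

      partner≢ : ∀ i → partner i ≢ i
      partner≢ i with i Fin.≟ a
      ... | yes refl = λ b≡a → a≢b (sym b≡a)
      ... | no  i≢a  = λ a≡i → i≢a (sym a≡i)

      pointFactors : Vec Bool t → List (Fin t) → List (Factor n t)
      pointFactors e []       = []
      pointFactors e (i ∷ is) =
        if lookup e i then factor (partner i) (λ xs → f (lookup xs i)) ∷ pointFactors e is else pointFactors e is

      weight-pointFactors : ∀ e is xs → weight (pointFactors e is) xs ≡ productOn e xs is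
      weight-pointFactors e []       xs = refl
      weight-pointFactors e (i ∷ is) xs with lookup e i
      ... | true  = cong (_*_ (f (lookup xs i))) (weight-pointFactors e is xs)
      ... | false = weight-pointFactors e is xs

      pointFactors-admissible : ∀ e is → All (Admissible e₀) (pointFactors e is)
      pointFactors-admissible e []       = All.[]
      pointFactors-admissible e (i ∷ is) with lookup e i
      ... | true  = record
        { index∈e             = partner∈e₀ i
        ; value²≡1            = λ xs → Sign-square (±f (lookup xs i))
        ; value-ignores-index = λ xs y → cong f (Vec.lookup∘update′ (λ i≡p → partner≢ i (sym i≡p)) xs y)
        } All.∷ pointFactors-admissible e is
      ... | false = pointFactors-admissible e is

      constantFactor : ℤ → Factor n t
      constantFactor c = factor a (λ _ → c)

      constantFactor-admissible : ∀ {c} → Sign c → Admissible e₀ (constantFactor c)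
      constantFactor-admissible ±c = record
        { index∈e = a∈e₀ ; value²≡1 = λ _ → Sign-square ±c ; value-ignores-index = λ _ _ → refl }

      edgeFactors : Vec Bool t → Fin t → List (Factor n t)
      edgeFactors e j = constantFactor (edgeConstant e) ∷ factor j (λ xs → f (subsetSum e xs)) ∷ pointFactors e (List.allFin t)

      weight-edgeFactors : ∀ e j xs → weight (edgeFactors e j) xs ≡ edgeTerm e xs
      weight-edgeFactors e j xs = cong (_*_ (edgeConstant e)) (trans
        (cong (_*_ (f (subsetSum e xs))) (weight-pointFactors e (List.allFin t) xs)) (ℤ.*-comm (f (subsetSum e xs)) _))

      edgeFactors-admissible : ∀ e j → lookup e₀ j ≡ true → lookup e j ≡ false → All (Admissible e₀) (edgeFactors e j)
      edgeFactors-admissible e j j∈e₀ j∉e =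
        constantFactor-admissible (Sign-edgeConstant e) All.∷
        record
          { index∈e             = j∈e₀
          ; value²≡1            = λ xs → Sign-square (±f (subsetSum e xs))
          ; value-ignores-index = λ xs y → cong f (begin
              subsetSum e (xs [ j ]≔ y)   ≡⟨ subsetSum≡subsetSum′ e (xs [ j ]≔ y) ⟩
              subsetSum′ e (xs [ j ]≔ y)  ≡⟨ subsetSum′-update e xs j y j∉e ⟩
              subsetSum′ e xs             ≡⟨ subsetSum≡subsetSum′ e xs ⟨
              subsetSum e xs              ∎)
          } All.∷
        pointFactors-admissible e (List.allFin t)
        where open ≡-Reasoning

      otherFactors : (G : List (Vec Bool t)) → All (e₀ ⊈_) G → List (Factor n t)
      otherFactors []      All.[]                  = []
      otherFactors (e ∷ G) ((j , _) All.∷ missing) = edgeFactors e j ++ otherFactors G missing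

      weight-otherFactors : ∀ G missing xs → weight (otherFactors G missing) xs ≡ ∏[ e ∈ G ] edgeTerm e xs
      weight-otherFactors []      All.[]                  xs = refl
      weight-otherFactors (e ∷ G) ((j , _) All.∷ missing) xs =
        trans (∏-++ (edgeFactors e j) _ (λ φ → value φ xs)) (cong₂ _*_ (weight-edgeFactors e j xs) (weight-otherFactors G missing xs))

      otherFactors-admissible : ∀ G missing → All (Admissible e₀) (otherFactors G missing)
      otherFactors-admissible []      All.[]                          = All.[]
      otherFactors-admissible (e ∷ G) ((j , j∈e₀ , j∉e) All.∷ missing) =
        All.++⁺ (edgeFactors-admissible e j j∈e₀ j∉e) (otherFactors-admissible G missing)

      allFactors : (G : List (Vec Bool t)) → All (e₀ ⊈_) G → List (Factor n t)
      allFactors G missing = constantFactor (edgeConstant e₀) ∷ pointFactors e₀ (List.allFin t) ++ otherFactors G missing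

      ∑∏-edgeTerm≡form : ∀ G missing → ∑[ xs ∈ tuples n t ] ∏[ e ∈ e₀ ∷ G ] edgeTerm e xs ≡ form e₀ f (allFactors G missing)
      ∑∏-edgeTerm≡form G missing = ∑-cong (tuples n t) λ xs → begin
        edgeConstant e₀ * (productOn e₀ xs (List.allFin t) * f (subsetSum e₀ xs)) * ∏[ e ∈ G ] edgeTerm e xs
          ≡⟨ rearrange (edgeConstant e₀) _ (f (subsetSum e₀ xs)) _ ⟩
        f (subsetSum e₀ xs) * (edgeConstant e₀ * productOn e₀ xs (List.allFin t) * ∏[ e ∈ G ] edgeTerm e xs)
          ≡⟨ cong₂ (λ s w → f s * (edgeConstant e₀ * w * ∏[ e ∈ G ] edgeTerm e xs))
               (subsetSum≡subsetSum′ e₀ xs) (sym (weight-pointFactors e₀ (List.allFin t) xs)) ⟩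
        f (subsetSum′ e₀ xs) * (edgeConstant e₀ * weight (pointFactors e₀ (List.allFin t)) xs * ∏[ e ∈ G ] edgeTerm e xs)
          ≡⟨ cong (λ w → f (subsetSum′ e₀ xs) * (edgeConstant e₀ * weight (pointFactors e₀ (List.allFin t)) xs * w))
               (sym (weight-otherFactors G missing xs)) ⟩
        f (subsetSum′ e₀ xs) * (edgeConstant e₀ * weight (pointFactors e₀ (List.allFin t)) xs * weight (otherFactors G missing) xs)
          ≡⟨ cong (_*_ (f (subsetSum′ e₀ xs))) (trans (ℤ.*-assoc (edgeConstant e₀) _ _)
               (cong (_*_ (edgeConstant e₀)) (sym (∏-++ (pointFactors e₀ (List.allFin t)) _ (λ φ → value φ xs))))) ⟩
        f (subsetSum′ e₀ xs) * weight (allFactors G missing) xs ∎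
        where
        open ≡-Reasoning
        rearrange : ∀ c p s r → c * (p * s) * r ≡ s * (c * p * r)
        rearrange = solve-∀

      allFactors-admissible : ∀ G missing → All (Admissible e₀) (allFactors G missing)
      allFactors-admissible G missing = constantFactor-admissible (Sign-edgeConstant e₀) All.∷
        All.++⁺ (pointFactors-admissible e₀ (List.allFin t)) (otherFactors-admissible G missing)

    maximal-edge-bound : ∀ d₀ e₀ (others : List (Vec Bool t)) → 2 ≤ size e₀ → size e₀ ≤ suc d₀ →
      All (_≢ e₀) others → All (λ e → size e ≤ size e₀) others →
      ∑[ xs ∈ tuples n t ] ∏[ e ∈ e₀ ∷ others ] edgeTerm e xs ÷ #cube n ^ t ≤U[ suc d₀ ] f
    maximal-edge-bound d₀ e₀ others 2≤|e₀| |e₀|≤1+d₀ ≢e₀ ≤|e₀| with two-vertices e₀ 2≤|e₀|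
    ... | a , b , a∈e₀ , b∈e₀ , a≢b =
      subst (λ S → S ÷ #cube n ^ t ≤U[ suc d₀ ] f) (sym (∑∏-edgeTerm≡form e₀ a∈e₀ b∈e₀ a≢b others missing))
        (≤U-mono q≤d₀ (gowers-cauchy-schwarz e₀ q |e₀|≡1+q f (allFactors-admissible e₀ a∈e₀ b∈e₀ a≢b others missing)))
      where
      missing : All (e₀ ⊈_) others
      missing = All.zipWith (Product.uncurry ≢∧size≤⇒⊈) (≢e₀ , ≤|e₀|)
      q = ℕ.pred (size e₀)
      |e₀|≡1+q : size e₀ ≡ suc q
      |e₀|≡1+q = sym (ℕ.suc-pred (size e₀) {{ℕ.>-nonZero (ℕ.≤-trans (ℕ.s≤s ℕ.z≤n) 2≤|e₀|)}})
      q≤d₀ : q ≤ d₀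
      q≤d₀ = ℕ.s≤s⁻¹ (subst (_≤ suc d₀) |e₀|≡1+q |e₀|≤1+d₀)

    edgeSet-bound : ∀ d₀ (F : List (Vec Bool t)) → F ≢ [] → Unique F → All (λ e → 2 ≤ size e) F →
      All (λ e → size e ≤ suc d₀) F → ∑[ xs ∈ tuples n t ] ∏[ e ∈ F ] edgeTerm e xs ÷ #cube n ^ t ≤U[ suc d₀ ] f
    edgeSet-bound d₀ []      []≢[] = ⊥-elim ([]≢[] refl)
    edgeSet-bound d₀ (e ∷ F) _ unique 2≤ ≤1+d₀ with maximal-split size e F
    ... | e₀ , G₁ , G₂ , eq , maximal =
      subst (λ H → ∑[ xs ∈ tuples n t ] ∏[ e ∈ H ] edgeTerm e xs ÷ #cube n ^ t ≤U[ suc d₀ ] f) (sym eq)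
        (subst (λ S → S ÷ #cube n ^ t ≤U[ suc d₀ ] f) (sym (∑-cong (tuples n t) (λ xs → ∏-++-∷ G₁ (λ e → edgeTerm e xs))))
          (maximal-edge-bound d₀ e₀ (G₁ ++ G₂)
            (proj₁ (All-++-∷ G₁ (subst (All _) eq 2≤))) (proj₁ (All-++-∷ G₁ (subst (All _) eq ≤1+d₀)))
            (Unique-++-∷ G₁ (subst Unique eq unique)) (proj₂ (All-++-∷ G₁ (subst (All _) eq maximal)))))

    ∏-1+edgeTerm-accepted : ∀ E xs → Accepts f E xs → ∏[ e ∈ E ] (1ℤ + edgeTerm e xs) ≡ (+ 2) ^ length E
    ∏-1+edgeTerm-accepted []      xs All.[]                    = refl
    ∏-1+edgeTerm-accepted (e ∷ E) xs (value≡const All.∷ rest) = cong₂ _*_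
      (trans (cong (λ g → 1ℤ + edgeConstant e * g) value≡const) (1+c*c≡2 (Sign-edgeConstant e)))
      (∏-1+edgeTerm-accepted E xs rest)

    ∏-1+edgeTerm-rejected : ∀ E xs → ¬ Accepts f E xs → ∏[ e ∈ E ] (1ℤ + edgeTerm e xs) ≡ 0ℤ
    ∏-1+edgeTerm-rejected []      xs rejected = ⊥-elim (rejected All.[])
    ∏-1+edgeTerm-rejected (e ∷ E) xs rejected with edgeValue e xs ℤ.≟ edgeConstant e
    ... | yes value≡const = trans (cong (_*_ (1ℤ + edgeTerm e xs)) (∏-1+edgeTerm-rejected E xs (rejected ∘ (value≡const All.∷_))))
                                  (ℤ.*-zeroʳ (1ℤ + edgeTerm e xs))
    ... | no  value≢const = trans (cong (_* ∏[ e ∈ E ] (1ℤ + edgeTerm e xs))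
                                    (1+c*g≡0 (Sign-edgeConstant e) (Sign-edgeValue e xs) value≢const))
                                  (ℤ.*-zeroˡ (∏[ e ∈ E ] (1ℤ + edgeTerm e xs)))

    accepted-count : ∀ E → + length (List.filter (accepts? f E) (tuples n t)) * (+ 2) ^ length E
                             ≡ #cube n ^ t + ∑[ F ∈ nonemptySublists E ] ∑[ xs ∈ tuples n t ] ∏[ e ∈ F ] edgeTerm e xs
    accepted-count E = begin
      + length (List.filter (accepts? f E) (tuples n t)) * (+ 2) ^ length E
        ≡⟨ ∑-filter (accepts? f E) (tuples n t) _ _ (∏-1+edgeTerm-accepted E) (∏-1+edgeTerm-rejected E) ⟨
      ∑[ xs ∈ tuples n t ] ∏[ e ∈ E ] (1ℤ + edgeTerm e xs)
        ≡⟨ ∑-cong (tuples n t) (λ xs → ∏-1+ E (λ e → edgeTerm e xs)) ⟩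
      ∑[ xs ∈ tuples n t ] (1ℤ + ∑[ F ∈ nonemptySublists E ] ∏[ e ∈ F ] edgeTerm e xs)
        ≡⟨ ∑-+ (tuples n t) _ _ ⟩
      ∑[ xs ∈ tuples n t ] 1ℤ + ∑[ xs ∈ tuples n t ] ∑[ F ∈ nonemptySublists E ] ∏[ e ∈ F ] edgeTerm e xs
        ≡⟨ cong₂ _+_ (trans (∑-1 (tuples n t)) (#tuples n t)) (∑-comm (tuples n t) (nonemptySublists E) _) ⟩
      #cube n ^ t + ∑[ F ∈ nonemptySublists E ] ∑[ xs ∈ tuples n t ] ∏[ e ∈ F ] edgeTerm e xs ∎
      where open ≡-Reasoning

    acceptance-bound : ∀ d₀ (E : List (Vec Bool t)) → E ≢ [] → Unique E → All (λ e → 2 ≤ size e) E →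
      All (λ e → size e ≤ suc d₀) E →
      + length (List.filter (accepts? f E) (tuples n t)) * (+ 2) ^ length E - #cube n ^ t ÷ (+ 2) ^ length E * #cube n ^ t
        ≤U[ suc d₀ ] f
    acceptance-bound d₀ E E≢[] unique 2≤ ≤1+d₀ =
      subst (λ X → X ÷ (+ 2) ^ length E * #cube n ^ t ≤U[ suc d₀ ] f) (sym X≡∑T)
        (≤U-mono-÷ d₀ {Y = L * #cube n ^ t} (*-nonNeg {L} (ℤ.+≤+ ℕ.z≤n) (^-nonNeg t (#cube-nonNeg n)))
          (*-monoʳ-≤-nonNeg′ (^-nonNeg t (#cube-nonNeg n)) L≤2^m)
          (∑-≤U-const (suc d₀) (nonemptySublists E) T (0<L E E≢[]) (All.map bound (nonemptySublists-⊆ E))))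
      where
      L = + length (nonemptySublists E)
      T : List (Vec Bool t) → ℤ
      T F = ∑[ xs ∈ tuples n t ] ∏[ e ∈ F ] edgeTerm e xs
      X≡∑T : + length (List.filter (accepts? f E) (tuples n t)) * (+ 2) ^ length E - #cube n ^ t ≡ ∑ (nonemptySublists E) T
      X≡∑T = trans (cong (_- #cube n ^ t) (accepted-count E)) (cancel (#cube n ^ t) _)
        where
        cancel : ∀ a s → a + s - a ≡ s
        cancel = solve-∀
      bound : ∀ {F} → F ⊆ E × F ≢ [] → T F ÷ #cube n ^ t ≤U[ suc d₀ ] f
      bound {F} (F⊆E , F≢[]) = edgeSet-bound d₀ F F≢[] (Unique-resp-⊇ F⊆E unique) (All-resp-⊆ F⊆E 2≤) (All-resp-⊆ F⊆E ≤1+d₀)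
      0<L : ∀ E → E ≢ [] → 0ℤ ℤ.< + length (nonemptySublists E)
      0<L []      []≢[] = ⊥-elim ([]≢[] refl)
      0<L (e ∷ E) _     = ℤ.+<+ (ℕ.s≤s ℕ.z≤n)
      L≤2^m : L ℤ.≤ (+ 2) ^ length E
      L≤2^m = subst (L ℤ.≤_) (trans (cong +_ (length-nonemptySublists E)) (pos-^ 2 (length E)))
        (ℤ.+≤+ (ℕ.n≤1+n _))

-- Passing to the rationals

infix 4 _≃_÷_

record _≃_÷_ (q : ℚᵘ) (x y : ℤ) : Set where
  constructor mk≃÷
  field
    cross-multiplied : ↥ q * y ≡ x * ↧ q

≃÷-+ : ∀ p q {x₁ y₁ x₂ y₂} → p ≃ x₁ ÷ y₁ → q ≃ x₂ ÷ y₂ → p ℚᵘ.+ q ≃ x₁ * y₂ + x₂ * y₁ ÷ y₁ * y₂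
≃÷-+ (mkℚᵘ a u) (mkℚᵘ b v) {x₁} {y₁} {x₂} {y₂} (mk≃÷ p≃) (mk≃÷ q≃) = mk≃÷ (begin
  (a * V + b * U) * (y₁ * y₂)                 ≡⟨ spread a b U V y₁ y₂ ⟩
  (a * y₁) * (V * y₂) + (b * y₂) * (U * y₁)   ≡⟨ cong₂ (λ l r → l * (V * y₂) + r * (U * y₁)) p≃ q≃ ⟩
  (x₁ * U) * (V * y₂) + (x₂ * V) * (U * y₁)   ≡⟨ collect x₁ x₂ U V y₁ y₂ ⟩
  (x₁ * y₂ + x₂ * y₁) * (U * V)               ≡⟨ cong (_*_ (x₁ * y₂ + x₂ * y₁)) (ℤ.pos-* (suc u) (suc v)) ⟨
  (x₁ * y₂ + x₂ * y₁) * + (suc u ℕ.* suc v)   ∎)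
  where
  open ≡-Reasoning
  U = + suc u
  V = + suc v
  spread : ∀ a b U V y₁ y₂ → (a * V + b * U) * (y₁ * y₂) ≡ (a * y₁) * (V * y₂) + (b * y₂) * (U * y₁)
  spread = solve-∀
  collect : ∀ x₁ x₂ U V y₁ y₂ → (x₁ * U) * (V * y₂) + (x₂ * V) * (U * y₁) ≡ (x₁ * y₂ + x₂ * y₁) * (U * V)
  collect = solve-∀

≃÷-* : ∀ p q {x₁ y₁ x₂ y₂} → p ≃ x₁ ÷ y₁ → q ≃ x₂ ÷ y₂ → p ℚᵘ.* q ≃ x₁ * x₂ ÷ y₁ * y₂
≃÷-* (mkℚᵘ a u) (mkℚᵘ b v) {x₁} {y₁} {x₂} {y₂} (mk≃÷ p≃) (mk≃÷ q≃) = mk≃÷ (begin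
  (a * b) * (y₁ * y₂)               ≡⟨ *-interchange a b y₁ y₂ ⟩
  (a * y₁) * (b * y₂)               ≡⟨ cong₂ _*_ p≃ q≃ ⟩
  (x₁ * + suc u) * (x₂ * + suc v)   ≡⟨ *-interchange x₁ _ x₂ _ ⟩
  (x₁ * x₂) * (+ suc u * + suc v)   ≡⟨ cong (_*_ (x₁ * x₂)) (ℤ.pos-* (suc u) (suc v)) ⟨
  (x₁ * x₂) * + (suc u ℕ.* suc v)   ∎)
  where open ≡-Reasoning

≃÷-neg : ∀ p {x y} → p ≃ x ÷ y → ℚᵘ.- p ≃ - x ÷ y
≃÷-neg (mkℚᵘ a u) {x} {y} (mk≃÷ p≃) = mk≃÷ (trans (sym (ℤ.neg-distribˡ-* a y)) (trans (cong -_ p≃) (ℤ.neg-distribˡ-* x (+ suc u))))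

≃÷-resp-≃ : ∀ p q {x y} → p ≃ x ÷ y → p ℚᵘ.≃ q → q ≃ x ÷ y
≃÷-resp-≃ (mkℚᵘ a u) (mkℚᵘ b v) {x} {y} (mk≃÷ p≃) (ℚᵘ.*≡* a*V≡b*U) = mk≃÷ (ℤ.*-cancelʳ-≡ (b * y) (x * V) U (begin
  b * y * U      ≡⟨ *-right-comm b y U ⟩
  (b * U) * y    ≡⟨ cong (_* y) a*V≡b*U ⟨
  (a * V) * y    ≡⟨ *-right-comm a V y ⟩
  (a * y) * V    ≡⟨ cong (_* V) p≃ ⟩
  (x * U) * V    ≡⟨ *-right-comm x U V ⟩
  x * V * U      ∎))
  where
  open ≡-Reasoning
  U = + suc u
  V = + suc v

≃÷-≤ : ∀ p q {x y x′ y′} → p ≃ x ÷ y → q ≃ x′ ÷ y′ → 0ℤ ℤ.< y → 0ℤ ℤ.< y′ → x * y′ ℤ.≤ x′ * y → p ℚᵘ.≤ q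
≃÷-≤ (mkℚᵘ a u) (mkℚᵘ b v) {x} {y} {x′} {y′} (mk≃÷ p≃) (mk≃÷ q≃) 0<y 0<y′ cross =
  ℚᵘ.*≤* (*-cancelˡ-≤-pos′ (*-pos 0<y 0<y′) (begin
  (y * y′) * (a * V)     ≡⟨ shuffle₁ y y′ a V ⟩
  (a * y) * (V * y′)     ≡⟨ cong (_* (V * y′)) p≃ ⟩
  (x * U) * (V * y′)     ≡⟨ shuffle₂ x U V y′ ⟩
  (x * y′) * (U * V)     ≤⟨ *-monoʳ-≤-nonNeg′ (*-nonNeg {U} {V} (ℤ.+≤+ ℕ.z≤n) (ℤ.+≤+ ℕ.z≤n)) cross ⟩
  (x′ * y) * (U * V)     ≡⟨ shuffle₃ x′ y U V ⟩
  (x′ * V) * (U * y)     ≡⟨ cong (_* (U * y)) q≃ ⟨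
  (b * y′) * (U * y)     ≡⟨ shuffle₄ y y′ b U ⟩
  (y * y′) * (b * U)     ∎))
  where
  open ℤ.≤-Reasoning
  U = + suc u
  V = + suc v
  shuffle₁ : ∀ y y′ a V → (y * y′) * (a * V) ≡ (a * y) * (V * y′)
  shuffle₁ = solve-∀
  shuffle₂ : ∀ x U V y′ → (x * U) * (V * y′) ≡ (x * y′) * (U * V)
  shuffle₂ = solve-∀
  shuffle₃ : ∀ x′ y U V → (x′ * y) * (U * V) ≡ (x′ * V) * (U * y)
  shuffle₃ = solve-∀
  shuffle₄ : ∀ y y′ b U → (b * y′) * (U * y) ≡ (y * y′) * (b * U)
  shuffle₄ = solve-∀

/2^-≃÷ : ∀ a k → ℚ.toℚᵘ (a /2^ k) ≃ a ÷ + (2 ℕ.^ k)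
/2^-≃÷ a k = ≃÷-resp-≃ (mkℚᵘ a (ℕ.pred 2^k)) (ℚ.toℚᵘ (a /2^ k)) (mk≃÷ (cong (_*_ a) (cong +_ 2^k≡1+pred)))
  (ℚᵘ.≃-sym (ℚᵘ.≃-trans (ℚ.toℚᵘ-cong /2^≡fromℚᵘ) (ℚ.toℚᵘ-fromℚᵘ _)))
  where
  2^k = 2 ℕ.^ k
  2^k≡1+pred : 2^k ≡ suc (ℕ.pred 2^k)
  2^k≡1+pred = sym (ℕ.suc-pred 2^k {{ℕ.m^n≢0 2 k}})
  /2^≡fromℚᵘ : a /2^ k ≡ ℚ.fromℚᵘ (mkℚᵘ a (ℕ.pred 2^k))
  /2^≡fromℚᵘ = ℚ./-cong {a} {2^k} {a} {suc (ℕ.pred 2^k)} {{ℕ.m^n≢0 2 k}} refl 2^k≡1+pred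

≃÷-^ℚ : ∀ q k {x y} → ℚ.toℚᵘ q ≃ x ÷ y → ℚ.toℚᵘ (q ^ℚ k) ≃ x ^ k ÷ y ^ k
≃÷-^ℚ q zero    q≃ = mk≃÷ refl
≃÷-^ℚ q (suc k) q≃ = ≃÷-resp-≃ _ _ (≃÷-* (ℚ.toℚᵘ q) _ q≃ (≃÷-^ℚ q k q≃)) (ℚᵘ.≃-sym (ℚ.toℚᵘ-homo-* q (q ^ℚ k)))

≃÷-- : ∀ p q {x₁ y₁ x₂ y₂} → ℚ.toℚᵘ p ≃ x₁ ÷ y₁ → ℚ.toℚᵘ q ≃ x₂ ÷ y₂ →
  ℚ.toℚᵘ (p ℚ.- q) ≃ x₁ * y₂ + (- x₂) * y₁ ÷ y₁ * y₂
≃÷-- p q p≃ q≃ = ≃÷-resp-≃ _ _ (≃÷-+ (ℚ.toℚᵘ p) _ p≃ (≃÷-neg (ℚ.toℚᵘ q) q≃))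
  (ℚᵘ.≃-sym (ℚᵘ.≃-trans (ℚ.toℚᵘ-homo-+ p (ℚ.- q)) (ℚᵘ.+-congʳ (ℚ.toℚᵘ p) (ℚ.toℚᵘ-homo‿- q))))

#cube^≡2^ : ∀ n k → #cube n ^ k ≡ + (2 ℕ.^ (n ℕ.* k))
#cube^≡2^ n k = begin
  #cube n ^ k           ≡⟨ cong (_^ k) (#cube≡2^ n) ⟩
  ((+ 2) ^ n) ^ k       ≡⟨ ℤ.^-*-assoc (+ 2) n k ⟩
  (+ 2) ^ (n ℕ.* k)     ≡⟨ pos-^ 2 (n ℕ.* k) ⟨
  + (2 ℕ.^ (n ℕ.* k))   ∎
  where open ≡-Reasoning

2^-pos : ∀ k → 0ℤ ℤ.< + (2 ℕ.^ k)
2^-pos k = ℤ.+<+ (ℕ.m^n>0 2 k)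

≤U⇒gowersPow-bound : ∀ {n} t m d (A : ℤ) (f : Cube n → ℤ) →
  A * (+ 2) ^ m - #cube n ^ t ÷ (+ 2) ^ m * #cube n ^ t ≤U[ d ] f →
  ((A /2^ (n ℕ.* t) ℚ.- (+ 1) /2^ m) ^ℚ (2 ℕ.^ d)) ℚ.≤ gowersPow d f
≤U⇒gowersPow-bound {n} t m d A f (mk≤U bound) = ℚ.toℚᵘ-cancel-≤
  (≃÷-≤ _ _ (≃÷-^ℚ _ (2 ℕ.^ d) difference≃) (/2^-≃÷ G (n ℕ.* suc d))
    (^-pos (2 ℕ.^ d) (*-pos (2^-pos (n ℕ.* t)) (2^-pos m))) (2^-pos (n ℕ.* suc d)) cross)
  where
  open ℤ.≤-Reasoning
  N = #cube n
  M = + (2 ℕ.^ m)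
  D = + (2 ℕ.^ (n ℕ.* t))
  X = A * (+ 2) ^ m - N ^ t
  X′ = A * M + (- + 1) * D
  G = sumℤ (concatMap (λ x → map (λ ys → prodℤ (map (λ S → f (x ⊕ subsetSum S ys)) (cube d))) (tuples n d)) (cube n))
  difference≃ : ℚ.toℚᵘ (A /2^ (n ℕ.* t) ℚ.- (+ 1) /2^ m) ≃ X′ ÷ D * M
  difference≃ = ≃÷-- _ _ (/2^-≃÷ A (n ℕ.* t)) (/2^-≃÷ (+ 1) m)
  X′≡X : X′ ≡ X
  X′≡X = trans (cong₂ (λ M′ D′ → A * M′ + (- + 1) * D′) (pos-^ 2 m) (sym (#cube^≡2^ n t))) (minus A ((+ 2) ^ m) (N ^ t))
    where
    minus : ∀ a b c → a * b + (- + 1) * c ≡ a * b - c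
    minus = solve-∀
  Y≡DM : (+ 2) ^ m * N ^ t ≡ D * M
  Y≡DM = trans (ℤ.*-comm _ (N ^ t)) (cong₂ _*_ (#cube^≡2^ n t) (sym (pos-^ 2 m)))
  cross : X′ ^ (2 ℕ.^ d) * + (2 ℕ.^ (n ℕ.* suc d)) ℤ.≤ G * (D * M) ^ (2 ℕ.^ d)
  cross = begin
    X′ ^ (2 ℕ.^ d) * + (2 ℕ.^ (n ℕ.* suc d))  ≡⟨ cong₂ _*_ (trans (sym (^2^≡^ d X′)) (cong (_^2^ d) X′≡X))
                                                             (sym (#cube^≡2^ n (suc d))) ⟩
    X ^2^ d * N ^ suc d                        ≤⟨ bound ⟩
    ((+ 2) ^ m * N ^ t) ^2^ d * gowersSum d f  ≡⟨ ℤ.*-comm _ (gowersSum d f) ⟩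
    gowersSum d f * ((+ 2) ^ m * N ^ t) ^2^ d  ≡⟨ cong₂ _*_ (sym (gowersPow-numerator d f)) (trans (cong (_^2^ d) Y≡DM) (^2^≡^ d (D * M))) ⟩
    G * (D * M) ^ (2 ℕ.^ d)                    ∎

size≤maxEdge : ∀ {t} (E : List (Vec Bool t)) → All (λ e → size e ≤ maxEdge E) E
size≤maxEdge []      = All.[]
size≤maxEdge (e ∷ E) = ℕ.m≤m⊔n (size e) (maxEdge E) All.∷ All.map (λ ≤max → ℕ.≤-trans ≤max (ℕ.m≤n⊔m (size e) _)) (size≤maxEdge E)

maxEdge-pos : ∀ {t} (E : List (Vec Bool t)) → All (λ e → size e ≥ 2) E → E ≢ [] → 0 ℕ.< maxEdge E
maxEdge-pos []      _              []≢[] = ⊥-elim ([]≢[] refl)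
maxEdge-pos (e ∷ E) (2≤|e| All.∷ _) _    = ℕ.≤-trans (ℕ.s≤s ℕ.z≤n) (ℕ.≤-trans 2≤|e| (ℕ.m≤m⊔n (size e) (maxEdge E)))

Any⇒≢[] : ∀ {A : Set} {P : A → Set} {xs} → Any P xs → xs ≢ []
Any⇒≢[] (here _)  ()
Any⇒≢[] (there _) ()

theorem2p2 : (n t : ℕ) → 1 ≤ n →
    (E : List (Vec Bool t)) → Unique E → Any (λ _ → ⊤) E →
    All (λ e → size e ≥ 2) E →
    (f : Cube n → ℤ) → ((x : Cube n) → f x ≡ + 1 ⊎ f x ≡ - + 1) →
    LeqPlusGowers (acceptProb f E) ((+ 1) /2^ (length E)) (maxEdge E) f
-- The bound holds for n = 0 too.
theorem2p2 n t _ E unique nonempty 2≤ f ±f =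
  subst (λ d → LeqPlusGowers (acceptProb f E) ((+ 1) /2^ (length E)) d f) (sym maxEdge≡1+d₀)
    (inj₂ (≤U⇒gowersPow-bound t (length E) (suc d₀) (+ length (List.filter (accepts? f E) (tuples n t))) f
      (acceptance-bound f ±f d₀ E (Any⇒≢[] nonempty) unique 2≤ (subst (λ d → All (λ e → size e ≤ d) E) maxEdge≡1+d₀ (size≤maxEdge E)))))
  where
  d₀ = ℕ.pred (maxEdge E)
  maxEdge≡1+d₀ : maxEdge E ≡ suc d₀
  maxEdge≡1+d₀ = sym (ℕ.suc-pred (maxEdge E) {{ℕ.>-nonZero (maxEdge-pos E 2≤ (Any⇒≢[] nonempty))}})
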